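{- Let $\mathcal E$ be an exchangeability system for a noncommutative probability space $(\mathcal A,\phi)$ and $X_1,\dots,X_n\in\mathcal A$. Then $$K_n(X_1,\dots,X_n)=\sum_{\pi\in\Pi_n}\phi_\pi(X_1,\dots,X_n)\,\mu(\pi,\hat1_n).$$
   Context: A noncommutative probability space is a pair $(\mathcal A,\phi)$ of a complex unital algebra $\mathcal A$ and a unital linear functional $\phi$. An exchangeability system $\mathcal E$ for $(\mathcal A,\phi)$ consists of a noncommutative probability space $(\mathcal U,\tilde\phi)$ and embeddings (injective unital homomorphisms) $\iota_k:\mathcal A\to\mathcal U$, $k\in\mathbb N$, with $\tilde\phi\circ\iota_k=\phi$; write $X^{(k)}=\iota_k(X)$. It is required that for all $n$, all $X_1,\dots,X_n\in\mathcal A$, all indices $i_1,\dots,i_n\in\mathbb N$ and every permutation $\sigma$ of $\mathbb N$: $\tilde\phi(X_1^{(i_1)}\cdots X_n^{(i_n)})=\tilde\phi(X_1^{(\sigma(i_1))}\cdots X_n^{(\sigma(i_n))})$. Thus this value depends only on the kernel of $j\mapsto i_j$ (the partition of $[n]=\{1,\dots,n\}$ into level sets); for $\pi\in\Pi_n$ denote it $\phi_\pi(X_1,\dots,X_n)$. Here $\Pi_n$ is the lattice of set partitions of $[n]$ ordered by refinement, $\hat1_n$ its maximum (one block), and $\mu$ its Möbius function. The cumulant is $K_n(X_1,\dots,X_n)=\frac1n\tilde\phi(X_1^\omega\cdots X_n^\omega)$, with $\omega$ a primitive $n$-th root of unity and $X_j^\omega=\sum_{k=1}^n\omega^kX_j^{(k)}$.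 -}

module Defs where

open import Level using (Level; _⊔_) renaming (suc to lsuc)
open import Algebra.Bundles using (CommutativeRing; Ring)
open import Data.Nat using (ℕ; zero; suc; _≡ᵇ_)
open import Data.Bool using (Bool; true; false; _∧_; not; if_then_else_)
open import Data.Fin using (Fin)
import Data.Fin as F
open import Data.List using (List; []; _∷_; map; concatMap; filter; upTo; allFin; foldr)
open import Data.Vec using (Vec; []; _∷_; lookup; replicate)
open import Relation.Nullary using (¬_)
open import Relation.Binary.PropositionalEquality using (_≡_)
open import Function.Bundles using (_↔_; Inverse)

record Field c ℓ : Set (lsuc (c ⊔ ℓ)) where
  field
    commutativeRing : CommutativeRing c ℓ
  open CommutativeRing commutativeRing public
  field
    0≉1   : ¬ (0# ≈ 1#)
    inv   : (x : Carrier) → ¬ (x ≈ 0#) → Carrier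
    inv-r : (x : Carrier) (p : ¬ (x ≈ 0#)) → x * inv x p ≈ 1#

module _ {c ℓ} (K : Field c ℓ) where
  open Field K

  natK : ℕ → Carrier
  natK zero    = 0#
  natK (suc m) = 1# + natK m

  CharZero : Set ℓ
  CharZero = ∀ m → ¬ (natK (suc m) ≈ 0#)

  powK : Carrier → ℕ → Carrier
  powK x zero    = 1#
  powK x (suc m) = x * powK x m

  PrimitiveRoot : ℕ → Carrier → Set ℓ
  PrimitiveRoot n ω = (powK ω n ≈ 1#) × (∀ k → 1 ≤ k → k < n → ¬ (powK ω k ≈ 1#))
    where open import Data.Product using (_×_)
          open import Data.Nat using (_≤_; _<_)

  sumK : List Carrier → Carrier
  sumK = foldr _+_ 0#

record UnitalAlgebra {c ℓ} (K : Field c ℓ) a ℓa : Set (c ⊔ ℓ ⊔ lsuc (a ⊔ ℓa)) where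
  module K = Field K
  field
    ring : Ring a ℓa
  open Ring ring public
  field
    _·_      : K.Carrier → Carrier → Carrier
    ·-cong   : ∀ {s t x y} → s K.≈ t → x ≈ y → (s · x) ≈ (t · y)
    ·-distribˡ : ∀ s x y → (s · (x + y)) ≈ ((s · x) + (s · y))
    ·-distribʳ : ∀ s t x → ((s K.+ t) · x) ≈ ((s · x) + (t · x))
    ·-assoc  : ∀ s t x → ((s K.* t) · x) ≈ (s · (t · x))
    ·-identity : ∀ x → (K.1# · x) ≈ x
    ·-*ˡ     : ∀ s x y → (s · (x * y)) ≈ ((s · x) * y)
    ·-*ʳ     : ∀ s x y → (s · (x * y)) ≈ (x * (s · y))

module _ {c ℓ a ℓa} {K : Field c ℓ} (A : UnitalAlgebra K a ℓa) where
  private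
    module A = UnitalAlgebra A
    module K = Field K

  record IsState (φ : A.Carrier → K.Carrier) : Set (a ⊔ ℓa ⊔ c ⊔ ℓ) where
    field
      cong   : ∀ {x y} → x A.≈ y → φ x K.≈ φ y
      additive : ∀ x y → φ (x A.+ y) K.≈ (φ x K.+ φ y)
      homogeneous : ∀ s x → φ (s A.· x) K.≈ (s K.* φ x)
      unital : φ A.1# K.≈ K.1#

  prodA : (n : ℕ) → (Fin n → A.Carrier) → A.Carrier
  prodA zero    f = A.1#
  prodA (suc n) f = f F.zero A.* prodA n (λ j → f (F.suc j))

  sumA : List A.Carrier → A.Carrier
  sumA = foldr A._+_ A.0#

record IsEmbedding {c ℓ a ℓa b ℓb} {K : Field c ℓ}
         (A : UnitalAlgebra K a ℓa) (B : UnitalAlgebra K b ℓb)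
         (f : UnitalAlgebra.Carrier A → UnitalAlgebra.Carrier B) : Set (c ⊔ a ⊔ ℓa ⊔ b ⊔ ℓb) where
  private
    module A = UnitalAlgebra A
    module B = UnitalAlgebra B
  field
    cong      : ∀ {x y} → x A.≈ y → f x B.≈ f y
    injective : ∀ {x y} → f x B.≈ f y → x A.≈ y
    +-hom     : ∀ x y → f (x A.+ y) B.≈ (f x B.+ f y)
    *-hom     : ∀ x y → f (x A.* y) B.≈ (f x B.* f y)
    ·-hom     : ∀ s x → f (s A.· x) B.≈ (s B.· f x)
    1-hom     : f A.1# B.≈ B.1#

record NCProbSpace {c ℓ} (K : Field c ℓ) a ℓa : Set (c ⊔ ℓ ⊔ lsuc (a ⊔ ℓa)) where
  field
    alg     : UnitalAlgebra K a ℓa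
    φ       : UnitalAlgebra.Carrier alg → Field.Carrier K
    isState : IsState alg φ

record ExchangeabilitySystem {c ℓ a ℓa} {K : Field c ℓ} (𝒜 : NCProbSpace K a ℓa) u ℓu
         : Set (c ⊔ ℓ ⊔ a ⊔ ℓa ⊔ lsuc (u ⊔ ℓu)) where
  private
    module 𝒜 = NCProbSpace 𝒜
    module A = UnitalAlgebra 𝒜.alg
    module K = Field K
  field
    𝒰  : NCProbSpace K u ℓu
  private
    module U = UnitalAlgebra (NCProbSpace.alg 𝒰)
  φ̃ : U.Carrier → K.Carrier
  φ̃ = NCProbSpace.φ 𝒰
  field
    ι            : ℕ → A.Carrier → U.Carrier
    ι-embedding  : ∀ k → IsEmbedding 𝒜.alg (NCProbSpace.alg 𝒰) (ι k)
    ι-compatible : ∀ k x → φ̃ (ι k x) K.≈ 𝒜.φ x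
    exchangeable : ∀ n (X : Fin n → A.Carrier) (i : Fin n → ℕ) (σ : ℕ ↔ ℕ) →
                   φ̃ (prodA (NCProbSpace.alg 𝒰) n (λ j → ι (i j) (X j)))
                     K.≈ φ̃ (prodA (NCProbSpace.alg 𝒰) n (λ j → ι (Inverse.to σ (i j)) (X j)))

-- Set partitions of [n], encoded canonically as restricted growth strings:
-- a partition π of {0,…,n-1} is the vector of block labels (π j = index of
-- the block of j, blocks numbered in order of their least elements).

-- rgsFrom k m : all restricted growth suffixes of length k when m labels
-- (0,…,m-1) have already been used.
rgsFrom : (k : ℕ) → ℕ → List (Vec ℕ k)
rgsFrom zero    m = [] ∷ []
rgsFrom (suc k) m =
  concatMap (λ l → map (l ∷_) (rgsFrom k (if l ≡ᵇ m then suc m else m))) (upTo (suc m))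

Π : (n : ℕ) → List (Vec ℕ n)
Π n = rgsFrom n 0

top : (n : ℕ) → Vec ℕ n
top n = replicate n 0

eqVec : ∀ {n} → Vec ℕ n → Vec ℕ n → Bool
eqVec []       []       = true
eqVec (x ∷ xs) (y ∷ ys) = (x ≡ᵇ y) ∧ eqVec xs ys

allB : ∀ {x} {X : Set x} → (X → Bool) → List X → Bool
allB p = foldr (λ x b → p x ∧ b) true

_≤ᵖ_ : ∀ {n} → Vec ℕ n → Vec ℕ n → Bool
_≤ᵖ_ {n} π σ = allB (λ i → allB (λ j → not (lookup π i ≡ᵇ lookup π j) Data.Bool.∨ (lookup σ i ≡ᵇ lookup σ j)) (allFin n)) (allFin n)
  where import Data.Bool

_<ᵖ_ : ∀ {n} → Vec ℕ n → Vec ℕ n → Bool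
π <ᵖ σ = (π ≤ᵖ σ) ∧ not (eqVec π σ)

module _ {c ℓ} (K : Field c ℓ) where
  open Field K

  -- The recursion is run with a fuel argument; chains in Πₙ have length < n,
  -- so fuel (suc n) is always sufficient.
  möbiusF : ℕ → (n : ℕ) → Vec ℕ n → Vec ℕ n → Carrier
  möbiusF zero       n π σ = 0#
  möbiusF (suc fuel) n π σ =
    if eqVec π σ then 1#
    else if π ≤ᵖ σ
         then - sumK K (map (möbiusF fuel n π) (filter (λ ρ → Data.Bool.T? ((π ≤ᵖ ρ) ∧ (ρ <ᵖ σ))) (Π n)))
         else 0#
    where import Data.Bool

  μ : (n : ℕ) → Vec ℕ n → Vec ℕ n → Carrier
  μ n = möbiusF (suc n) n

module _ {c ℓ a ℓa u ℓu} {K : Field c ℓ} {𝒜 : NCProbSpace K a ℓa}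
         (ℰ : ExchangeabilitySystem 𝒜 u ℓu) where
  private
    module A = UnitalAlgebra (NCProbSpace.alg 𝒜)
    module ℰ = ExchangeabilitySystem ℰ
    𝒰alg = NCProbSpace.alg ℰ.𝒰
    module U = UnitalAlgebra 𝒰alg
    module K = Field K

  -- φ_π(X₁,…,Xₙ) = φ̃(X₁^(i₁) ⋯ Xₙ^(iₙ)) for an index tuple with kernel π;
  -- we use the block labels of π themselves as the indices.
  φ_ : ∀ {n} → Vec ℕ n → (Fin n → A.Carrier) → K.Carrier
  φ_ {n} π X = ℰ.φ̃ (prodA 𝒰alg n (λ j → ℰ.ι (lookup π j) (X j)))

  Xω : (n : ℕ) → K.Carrier → A.Carrier → U.Carrier
  Xω n ω x = sumA 𝒰alg (map (λ k → powK K ω k U.· ℰ.ι k x) (Data.List.map suc (upTo n)))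
    where import Data.List

  cumulant : (n : ℕ) (ω : K.Carrier) (nz : ¬ (natK K n K.≈ K.0#)) → (Fin n → A.Carrier) → K.Carrier
  cumulant n ω nz X = K.inv (natK K n) nz K.* ℰ.φ̃ (prodA 𝒰alg n (λ j → Xω n ω (X j)))

-- Expanding X_j^ω = Σ_k ω^k X_j^(k) gives
--   φ̃(X₁^ω ⋯ Xₙ^ω) = Σ_{i ∈ [1,n]ⁿ} ω^(i₁+⋯+iₙ) φ̃(X₁^(i₁) ⋯ Xₙ^(iₙ)).
-- By exchangeability the term of i is φ_τ for τ the kernel of i, and Möbius inversion on Πₙ
-- writes φ_τ = Σ_π φ_π Σ_{π ≤ ρ ≤ τ} μ(π,ρ). Exchanging the sums leaves, for each ρ, the sum of
-- ω^(i₁+⋯+iₙ) over the i that are constant on the blocks of ρ. Rotating the indices cyclically on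
-- one block B multiplies that sum by ω^|B|, so it vanishes unless ρ = 1̂ₙ, where it equals n.
-- Hence φ̃(X₁^ω ⋯ Xₙ^ω) = n Σ_π φ_π μ(π,1̂ₙ), and dividing by n gives the formula.

{-# OPTIONS --safe #-}
module Submission where

open import Defs
open import Data.Nat using (ℕ; suc)
open import Data.Fin using (Fin)
open import Data.List using (map)

open import Level using (Level)
open import Algebra.Bundles using (Semiring)
open import Data.Bool using (Bool; true; false; _∧_; _∨_; not; if_then_else_; T)
open import Data.Bool.Properties using (T-∧; T-≡; ∧-identityʳ)
open import Data.Empty using (⊥-elim)
open import Data.Fin using (toℕ) renaming (zero to fzero; suc to fsuc)
import Data.Fin.Properties as Fin
open import Data.Fin.Subset as Subset using (Subset; ∣_∣; _⊆_)
import Data.Fin.Subset.Properties as Subset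
open import Data.Nat as Nat using (zero; _≡ᵇ_; _<_; _≤_; s≤s; z≤n; _∸_)
import Data.Nat.Properties as ℕ
open import Data.List
  using (List; []; _∷_; _++_; _∷ʳ_; concatMap; filter; foldr; length; upTo; applyUpTo; allFin)
import Data.List.Properties as List
open import Data.List.Membership.Propositional using (_∈_; _∉_; find)
open import Data.List.Membership.Propositional.Properties
  using (∈-filter⁻; ∈-++⁺ˡ; ∈-++⁺ʳ; ∈-allFin; ∈-concatMap⁻; ∈-map⁻; ∈-upTo⁺; ∈-upTo⁻)
open import Data.List.Membership.DecPropositional ℕ._≟_ using (_∈?_)
open import Data.List.Relation.Unary.Any using (here; there)
import Data.List.Relation.Unary.All as All
open import Data.List.Relation.Unary.AllPairs using (_∷_)
open import Data.List.Relation.Unary.Unique.Propositional using (Unique)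
open import Data.List.Relation.Unary.Unique.Propositional.Properties
  using (upTo⁺) renaming (map⁺ to Unique-map⁺)
open import Data.Product using (_×_; _,_; proj₁; proj₂; ∃)
open import Data.Sum using (_⊎_; inj₁; inj₂)
open import Data.Unit using (⊤)
open import Data.Vec using (Vec; []; _∷_; lookup; replicate; tabulate; zipWith; countᵇ)
import Data.Vec.Properties as Vec
open import Function using (_∘_; id)
open import Function.Bundles using (Equivalence; _↔_; mk↔ₛ′)
open import Relation.Binary using (tri<; tri≈; tri>)
import Relation.Binary.PropositionalEquality as ≡
open ≡ using (_≡_; _≢_)
open import Relation.Nullary using (¬_; Dec; yes; no; does; T?; ¬?; _×-dec_; decidable-stable)
open import Relation.Nullary.Decidable using (dec-true; dec-false)

if-T : ∀ {a} {A : Set a} {p} (x y : A) → T p → (if p then x else y) ≡ x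
if-T {p = true} x y _ = ≡.refl

if-¬T : ∀ {a} {A : Set a} {p} (x y : A) → ¬ T p → (if p then x else y) ≡ y
if-¬T {p = true}  x y ¬p = ⊥-elim (¬p _)
if-¬T {p = false} x y ¬p = ≡.refl

T-⇔⇒≡ : ∀ {p q} → (T p → T q) → (T q → T p) → p ≡ q
T-⇔⇒≡ {true}  {true}  _   _   = ≡.refl
T-⇔⇒≡ {false} {false} _   _   = ≡.refl
T-⇔⇒≡ {true}  {false} p⇒q _   = ⊥-elim (p⇒q _)
T-⇔⇒≡ {false} {true}  _   q⇒p = ⊥-elim (q⇒p _)

T-not-∨⁻ : ∀ {p q} → T (not p ∨ q) → T p → T q
T-not-∨⁻ {true} t _ = t

T-not-∨⁺ : ∀ {p q} → (T p → T q) → T (not p ∨ q)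
T-not-∨⁺ {true}  f = f _
T-not-∨⁺ {false} f = _

allB⁻ : ∀ {a} {A : Set a} (p : A → Bool) {xs} → T (allB p xs) → ∀ {x} → x ∈ xs → T (p x)
allB⁻ p {x ∷ xs} t (here ≡.refl) = proj₁ (Equivalence.to (T-∧ {p x}) t)
allB⁻ p {x ∷ xs} t (there x∈xs) = allB⁻ p (proj₂ (Equivalence.to (T-∧ {p x}) t)) x∈xs

allB⁺ : ∀ {a} {A : Set a} (p : A → Bool) xs → (∀ {x} → x ∈ xs → T (p x)) → T (allB p xs)
allB⁺ p []       _ = _
allB⁺ p (x ∷ xs) h = Equivalence.from T-∧ (h (here ≡.refl) , allB⁺ p xs (h ∘ there))

module ListSum {c ℓ} (R : Semiring c ℓ) where
  open Semiring R
  open import Algebra.Properties.CommutativeSemigroup +-commutativeSemigroup using (interchange)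
  open import Relation.Binary.Reasoning.Setoid setoid

  ∑ : ∀ {a} {A : Set a} → List A → (A → Carrier) → Carrier
  ∑ xs f = foldr _+_ 0# (map f xs)

  infixl 7 _when_
  _when_ : Carrier → Bool → Carrier
  x when b = if b then x else 0#

  private variable
    a b : Level
    A : Set a
    B : Set b

  ∑-cong-∈ : ∀ (xs : List A) {f g : A → Carrier} → (∀ {x} → x ∈ xs → f x ≈ g x) → ∑ xs f ≈ ∑ xs g
  ∑-cong-∈ []       f≈g = refl
  ∑-cong-∈ (x ∷ xs) f≈g = +-cong (f≈g (here ≡.refl)) (∑-cong-∈ xs (f≈g ∘ there))

  ∑-cong : ∀ (xs : List A) {f g : A → Carrier} → (∀ x → f x ≈ g x) → ∑ xs f ≈ ∑ xs g
  ∑-cong xs f≈g = ∑-cong-∈ xs (λ {x} _ → f≈g x)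

  ∑-++ : ∀ (xs ys : List A) (f : A → Carrier) → ∑ (xs ++ ys) f ≈ ∑ xs f + ∑ ys f
  ∑-++ []       ys f = sym (+-identityˡ _)
  ∑-++ (x ∷ xs) ys f = trans (+-congˡ (∑-++ xs ys f)) (sym (+-assoc _ _ _))

  ∑-map : ∀ (h : A → B) (xs : List A) (f : B → Carrier) → ∑ (map h xs) f ≈ ∑ xs (λ x → f (h x))
  ∑-map h []       f = refl
  ∑-map h (x ∷ xs) f = +-congˡ (∑-map h xs f)

  ∑-concatMap : ∀ (h : A → List B) (xs : List A) (f : B → Carrier) →
                ∑ (concatMap h xs) f ≈ ∑ xs (λ x → ∑ (h x) f)
  ∑-concatMap h []       f = refl
  ∑-concatMap h (x ∷ xs) f = trans (∑-++ (h x) (concatMap h xs) f) (+-congˡ (∑-concatMap h xs f))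

  ∑-0 : ∀ (xs : List A) → ∑ xs (λ _ → 0#) ≈ 0#
  ∑-0 []       = refl
  ∑-0 (x ∷ xs) = trans (+-identityˡ _) (∑-0 xs)

  ∑-+ : ∀ (xs : List A) (f g : A → Carrier) → ∑ xs (λ x → f x + g x) ≈ ∑ xs f + ∑ xs g
  ∑-+ []       f g = sym (+-identityˡ 0#)
  ∑-+ (x ∷ xs) f g = trans (+-congˡ (∑-+ xs f g)) (interchange _ _ _ _)

  ∑-comm : ∀ (xs : List A) (ys : List B) (f : A → B → Carrier) →
           ∑ xs (λ x → ∑ ys (f x)) ≈ ∑ ys (λ y → ∑ xs (λ x → f x y))
  ∑-comm []       ys f = sym (∑-0 ys)
  ∑-comm (x ∷ xs) ys f = trans (+-congˡ (∑-comm xs ys f)) (sym (∑-+ ys (f x) _))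

  *-∑ : ∀ c (xs : List A) (f : A → Carrier) → c * ∑ xs f ≈ ∑ xs (λ x → c * f x)
  *-∑ c []       f = zeroʳ c
  *-∑ c (x ∷ xs) f = trans (distribˡ c _ _) (+-congˡ (*-∑ c xs f))

  ∑-* : ∀ c (xs : List A) (f : A → Carrier) → ∑ xs f * c ≈ ∑ xs (λ x → f x * c)
  ∑-* c []       f = zeroˡ c
  ∑-* c (x ∷ xs) f = trans (distribʳ c _ _) (+-congˡ (∑-* c xs f))

  ∑-*-∑-comm : ∀ (xs : List A) (ys : List B) (g : A → Carrier) (f : A → B → Carrier) →
               ∑ xs (λ x → g x * ∑ ys (f x)) ≈ ∑ ys (λ y → ∑ xs (λ x → g x * f x y))
  ∑-*-∑-comm xs ys g f = trans (∑-cong xs (λ x → *-∑ (g x) ys (f x))) (∑-comm xs ys _)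

  weight : (ℕ → Carrier) → ∀ {k} → Vec ℕ k → Carrier
  weight f []      = 1#
  weight f (a ∷ i) = f a * weight f i

  when-∧ : ∀ x p q → x when (p ∧ q) ≡ (x when q) when p
  when-∧ x true  q = ≡.refl
  when-∧ x false q = ≡.refl

  when-cong-T : ∀ p {x y} → (T p → x ≈ y) → x when p ≈ y when p
  when-cong-T true  x≈y = x≈y _
  when-cong-T false x≈y = refl

  *-when : ∀ c x p → c * (x when p) ≈ (c * x) when p
  *-when c x true  = refl
  *-when c x false = zeroʳ c

  when≈*-1-when : ∀ x p → x when p ≈ x * (1# when p)
  when≈*-1-when x true  = sym (*-identityʳ x)
  when≈*-1-when x false = sym (zeroʳ x)

  when-T : ∀ x {p} → T p → x when p ≡ x
  when-T x = if-T x 0#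

  when-¬T : ∀ x {p} → ¬ T p → x when p ≡ 0#
  when-¬T x = if-¬T x 0#

  ∑-when : ∀ p (xs : List A) (f : A → Carrier) → ∑ xs (λ x → f x when p) ≈ ∑ xs f when p
  ∑-when true  xs f = refl
  ∑-when false xs f = ∑-0 xs

  ∑-when-none : ∀ (p : A → Bool) (xs : List A) (f : A → Carrier) → (∀ {x} → x ∈ xs → ¬ T (p x)) →
                ∑ xs (λ x → f x when p x) ≈ 0#
  ∑-when-none p xs f none = trans (∑-cong-∈ xs (λ x∈ → reflexive (when-¬T _ (none x∈)))) (∑-0 xs)

  ∑-filter : ∀ (p : A → Bool) (xs : List A) (f : A → Carrier) →
             ∑ (filter (λ x → T? (p x)) xs) f ≈ ∑ xs (λ x → f x when p x)
  ∑-filter p []       f = refl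
  ∑-filter p (x ∷ xs) f with p x
  ... | true  = +-congˡ (∑-filter p xs f)
  ... | false = trans (∑-filter p xs f) (sym (+-identityˡ _))

  ∑-when-≡ᵇ : ∀ {xs : List ℕ} {c} → Unique xs → c ∈ xs → (h : ℕ → Carrier) →
              ∑ xs (λ x → h x when (x ≡ᵇ c)) ≈ h c
  ∑-when-≡ᵇ {x ∷ xs} (x∉xs ∷ _) (here ≡.refl) h = begin
    h x when (x ≡ᵇ x) + ∑ xs (λ y → h y when (y ≡ᵇ x))
      ≈⟨ +-cong (reflexive (when-T _ (ℕ.≡⇒≡ᵇ x x ≡.refl)))
                (∑-when-none _ xs h λ y∈xs → All.lookup x∉xs y∈xs ∘ ≡.sym ∘ ℕ.≡ᵇ⇒≡ _ _) ⟩
    h x + 0#  ≈⟨ +-identityʳ (h x) ⟩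
    h x       ∎
  ∑-when-≡ᵇ {x ∷ xs} (x∉xs ∷ u) (there c∈xs) h = begin
    h x when (x ≡ᵇ _) + ∑ xs (λ y → h y when (y ≡ᵇ _))
      ≈⟨ +-cong (reflexive (when-¬T _ (All.lookup x∉xs c∈xs ∘ ℕ.≡ᵇ⇒≡ _ _))) (∑-when-≡ᵇ u c∈xs h) ⟩
    0# + h _  ≈⟨ +-identityˡ _ ⟩
    h _       ∎

module FieldProperties {c ℓ} (K : Field c ℓ) where
  open Field K
  open ListSum semiring
  open import Algebra.Properties.Ring ring using (-1*x≈-x)
  open import Algebra.Properties.Group +-group using (x∙y⁻¹≈ε⇒x≈y)
  open import Relation.Binary.Reasoning.Setoid setoid

  inv-cancelˡ : ∀ x (x≉0 : ¬ x ≈ 0#) y → inv x x≉0 * (x * y) ≈ y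
  inv-cancelˡ x x≉0 y = begin
    inv x x≉0 * (x * y)  ≈⟨ *-assoc _ _ _ ⟨
    (inv x x≉0 * x) * y  ≈⟨ *-congʳ (trans (*-comm _ _) (inv-r x x≉0)) ⟩
    1# * y               ≈⟨ *-identityˡ y ⟩
    y                    ∎

  fixed-by-≉1⇒≈0 : ∀ {x y} → ¬ y ≈ 1# → x ≈ y * x → x ≈ 0#
  fixed-by-≉1⇒≈0 {x} {y} y≉1 x≈yx = begin
    x                                 ≈⟨ inv-cancelˡ d d≉0 x ⟨
    inv d d≉0 * (d * x)               ≈⟨ *-congˡ dx≈0 ⟩
    inv d d≉0 * 0#                    ≈⟨ zeroʳ _ ⟩
    0#                                ∎
    where
    d = y + - 1#
    d≉0 : ¬ d ≈ 0#
    d≉0 = y≉1 ∘ x∙y⁻¹≈ε⇒x≈y y 1#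
    dx≈0 : d * x ≈ 0#
    dx≈0 = begin
      d * x             ≈⟨ distribʳ x y (- 1#) ⟩
      y * x + - 1# * x  ≈⟨ +-cong (sym x≈yx) (-1*x≈-x x) ⟩
      x + - x           ≈⟨ -‿inverseʳ x ⟩
      0#                ∎

  ∑-1 : ∀ {a} {A : Set a} (xs : List A) → ∑ xs (λ _ → 1#) ≈ natK K (length xs)
  ∑-1 []       = refl
  ∑-1 (x ∷ xs) = +-congˡ (∑-1 xs)

  powK-1 : ∀ k → powK K 1# k ≈ 1#
  powK-1 zero    = refl
  powK-1 (suc k) = trans (*-identityˡ _) (powK-1 k)

  powK-* : ∀ x y k → powK K (x * y) k ≈ powK K x k * powK K y k
  powK-* x y zero    = sym (*-identityˡ 1#)
  powK-* x y (suc k) = trans (*-congˡ (powK-* x y k)) (interchange x y _ _)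
    where open import Algebra.Properties.CommutativeSemigroup *-commutativeSemigroup using (interchange)

  powK-root : ∀ ω n → powK K ω n ≈ 1# → ∀ l → powK K (powK K ω l) n ≈ 1#
  powK-root ω n ωⁿ≈1 zero    = powK-1 n
  powK-root ω n ωⁿ≈1 (suc l) = begin
    powK K (ω * powK K ω l) n            ≈⟨ powK-* ω _ n ⟩
    powK K ω n * powK K (powK K ω l) n   ≈⟨ *-cong ωⁿ≈1 (powK-root ω n ωⁿ≈1 l) ⟩
    1# * 1#                              ≈⟨ *-identityˡ 1# ⟩
    1#                                   ∎

-- Set partitions of [n] as vectors of block labels

infix 4 _⊑_
_⊑_ : ∀ {n} → Vec ℕ n → Vec ℕ n → Set
π ⊑ σ = ∀ x y → lookup π x ≡ lookup π y → lookup σ x ≡ lookup σ y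

⊑-refl : ∀ {n} (π : Vec ℕ n) → π ⊑ π
⊑-refl π x y πx≡πy = πx≡πy

⊑-trans : ∀ {n} {π σ τ : Vec ℕ n} → π ⊑ σ → σ ⊑ τ → π ⊑ τ
⊑-trans π⊑σ σ⊑τ x y = σ⊑τ x y ∘ π⊑σ x y

⊑-top : ∀ {n} (π : Vec ℕ n) → π ⊑ top n
⊑-top {n} π x y _ = ≡.trans (Vec.lookup-replicate x 0) (≡.sym (Vec.lookup-replicate y 0))

≤ᵖ⇒⊑ : ∀ {n} (π σ : Vec ℕ n) → T (π ≤ᵖ σ) → π ⊑ σ
≤ᵖ⇒⊑ {n} π σ t x y πx≡πy = ℕ.≡ᵇ⇒≡ _ _
  (T-not-∨⁻ (allB⁻ _ (allB⁻ _ t (∈-allFin x)) (∈-allFin y)) (ℕ.≡⇒≡ᵇ _ _ πx≡πy))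

⊑⇒≤ᵖ : ∀ {n} (π σ : Vec ℕ n) → π ⊑ σ → T (π ≤ᵖ σ)
⊑⇒≤ᵖ {n} π σ π⊑σ = allB⁺ _ (allFin n) λ {x} _ → allB⁺ _ (allFin n) λ {y} _ →
  T-not-∨⁺ λ t → ℕ.≡⇒≡ᵇ _ _ (π⊑σ x y (ℕ.≡ᵇ⇒≡ _ _ t))

eqVec⇒≡ : ∀ {n} {u v : Vec ℕ n} → T (eqVec u v) → u ≡ v
eqVec⇒≡ {u = []}    {[]}    _ = ≡.refl
eqVec⇒≡ {u = a ∷ u} {b ∷ v} t with Equivalence.to (T-∧ {a ≡ᵇ b}) t
... | a≡b , u≡v = ≡.cong₂ _∷_ (ℕ.≡ᵇ⇒≡ a b a≡b) (eqVec⇒≡ u≡v)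

≡⇒eqVec : ∀ {n} {u v : Vec ℕ n} → u ≡ v → T (eqVec u v)
≡⇒eqVec {u = []}    ≡.refl = _
≡⇒eqVec {u = a ∷ u} ≡.refl = Equivalence.from T-∧ (ℕ.≡⇒≡ᵇ a a ≡.refl , ≡⇒eqVec {u = u} ≡.refl)

next : ℕ → ℕ → ℕ
next l m = if l ≡ᵇ m then suc m else m

IsRGS : ∀ {k} → ℕ → Vec ℕ k → Set
IsRGS m []      = ⊤
IsRGS m (l ∷ v) = l < suc m × IsRGS (next l m) v

∈-rgsFrom⇒IsRGS : ∀ {k m} {v : Vec ℕ k} → v ∈ rgsFrom k m → IsRGS m v
∈-rgsFrom⇒IsRGS {zero}  {v = []} _  = _
∈-rgsFrom⇒IsRGS {suc k} {m}      v∈ with find (∈-concatMap⁻ _ {xs = upTo (suc m)} v∈)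
... | l , l∈ , v∈′ with ∈-map⁻ (l ∷_) v∈′
...   | _ , y∈ , ≡.refl = ∈-upTo⁻ l∈ , ∈-rgsFrom⇒IsRGS y∈

⊑-tail : ∀ {k a b} {π σ : Vec ℕ k} → a ∷ π ⊑ b ∷ σ → π ⊑ σ
⊑-tail h x y = h (fsuc x) (fsuc y)

private
  AgreeBelow : ∀ {k} → ℕ → Vec ℕ k → Vec ℕ k → Set
  AgreeBelow m π σ = ∀ x → lookup π x < m → lookup π x ≡ lookup σ x

  <next⇒ : ∀ {y l m} → y < next l m → y < m ⊎ y ≡ l
  <next⇒ {y} {l} {m} y< with l ≡ᵇ m in l≡ᵇm
  ... | false = inj₁ y<
  ... | true with ℕ.m≤n⇒m<n∨m≡n (ℕ.≤-pred y<)
  ...   | inj₁ y<m = inj₁ y<m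
  ...   | inj₂ y≡m = inj₂ (≡.trans y≡m (≡.sym (ℕ.≡ᵇ⇒≡ l m (Equivalence.from T-≡ l≡ᵇm))))

  agreeBelow-tail : ∀ {k m l} {π σ : Vec ℕ k} → l ∷ π ⊑ l ∷ σ →
                    AgreeBelow m (l ∷ π) (l ∷ σ) → AgreeBelow (next l m) π σ
  agreeBelow-tail π⊑σ agree x πx< with <next⇒ πx<
  ... | inj₁ πx<m = agree (fsuc x) πx<m
  ... | inj₂ πx≡l = ≡.trans πx≡l (≡.sym (π⊑σ (fsuc x) fzero πx≡l))

  -- Induction along the strings, m being the number of labels used by a common prefix: a label
  -- below m already occurs in the prefix, so both strings agree on it, and a label that is new in
  -- one string is new in the other, hence equal to m in both.
  RGS-⊑-unique : ∀ {k m} {π σ : Vec ℕ k} → IsRGS m π → IsRGS m σ → π ⊑ σ → σ ⊑ π →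
                 AgreeBelow m π σ → AgreeBelow m σ π → π ≡ σ
  RGS-⊑-unique {π = []} {[]} _ _ _ _ _ _ = ≡.refl
  RGS-⊑-unique {m = m} {l ∷ π} {l′ ∷ σ} (l≤m , rπ) (l′≤m , rσ) π⊑σ σ⊑π agree agree′ with heads-equal
    where
    heads-equal : l ≡ l′
    heads-equal with l ℕ.<? m | l′ ℕ.<? m
    ... | yes l<m | _         = agree fzero l<m
    ... | no _    | yes l′<m  = ≡.sym (agree′ fzero l′<m)
    ... | no l≮m  | no l′≮m   = ≡.trans (ℕ.≤-antisym (ℕ.≤-pred l≤m) (ℕ.≮⇒≥ l≮m))
                                        (ℕ.≤-antisym (ℕ.≮⇒≥ l′≮m) (ℕ.≤-pred l′≤m))
  ... | ≡.refl = ≡.cong (l ∷_) (RGS-⊑-unique rπ rσ (⊑-tail π⊑σ) (⊑-tail σ⊑π)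
                                  (agreeBelow-tail π⊑σ agree) (agreeBelow-tail σ⊑π agree′))

RGS-⊑-antisym : ∀ {k} {π σ : Vec ℕ k} → IsRGS 0 π → IsRGS 0 σ → π ⊑ σ → σ ⊑ π → π ≡ σ
RGS-⊑-antisym rπ rσ π⊑σ σ⊑π = RGS-⊑-unique rπ rσ π⊑σ σ⊑π (λ _ ()) (λ _ ())

next-≢ : ∀ {l m} → l ≢ m → next l m ≡ m
next-≢ {l} {m} l≢m = if-¬T (suc m) m (l≢m ∘ ℕ.≡ᵇ⇒≡ l m)

next-≡ : ∀ m → next m m ≡ suc m
next-≡ m = if-T (suc m) m (ℕ.≡⇒≡ᵇ m m ≡.refl)

index : ℕ → List ℕ → ℕ
index a []      = 0
index a (b ∷ d) with a ℕ.≟ b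
... | yes _ = 0
... | no  _ = suc (index a d)

index-here : ∀ a d → index a (a ∷ d) ≡ 0
index-here a d with a ℕ.≟ a
... | yes _   = ≡.refl
... | no a≢a  = ⊥-elim (a≢a ≡.refl)

index-++-∈ : ∀ {a} d {e} → a ∈ d → index a (d ++ e) ≡ index a d
index-++-∈ {a} (b ∷ d) a∈ with a ℕ.≟ b | a∈
... | yes _   | _          = ≡.refl
... | no a≢b  | here a≡b   = ⊥-elim (a≢b a≡b)
... | no _    | there a∈d  = ≡.cong suc (index-++-∈ d a∈d)

index-++-∉ : ∀ {a} d {e} → a ∉ d → index a (d ++ e) ≡ length d Nat.+ index a e
index-++-∉     []      a∉ = ≡.refl
index-++-∉ {a} (b ∷ d) a∉ with a ℕ.≟ b
... | yes a≡b = ⊥-elim (a∉ (here a≡b))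
... | no  _   = ≡.cong suc (index-++-∉ d (a∉ ∘ there))

index-∉ : ∀ {a} d → a ∉ d → index a d ≡ length d
index-∉ {a} d a∉ = begin
  index a d          ≡⟨ ≡.cong (index a) (List.++-identityʳ d) ⟨
  index a (d ++ [])  ≡⟨ index-++-∉ d a∉ ⟩
  length d Nat.+ 0   ≡⟨ ℕ.+-identityʳ _ ⟩
  length d           ∎
  where open ≡.≡-Reasoning

index-≤ : ∀ a d → index a d ≤ length d
index-≤ a []      = z≤n
index-≤ a (b ∷ d) with a ℕ.≟ b
... | yes _ = z≤n
... | no  _ = s≤s (index-≤ a d)

index-<-∈ : ∀ {a d} → a ∈ d → index a d < length d
index-<-∈ {a} {b ∷ d} a∈ with a ℕ.≟ b | a∈
... | yes _  | _         = s≤s z≤n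
... | no a≢b | here a≡b  = ⊥-elim (a≢b a≡b)
... | no _   | there a∈d = s≤s (index-<-∈ a∈d)

index-injective : ∀ {a b d} → a ∈ d → index a d ≡ index b d → a ≡ b
index-injective {a} {b} {c ∷ d} a∈ eq with a ℕ.≟ c | b ℕ.≟ c | a∈
... | yes a≡c | yes b≡c | _         = ≡.trans a≡c (≡.sym b≡c)
... | no a≢c  | _       | here a≡c  = ⊥-elim (a≢c a≡c)
... | no _    | no _    | there a∈d = index-injective a∈d (ℕ.suc-injective eq)
... | no _    | yes _   | there _   = ⊥-elim (ℕ.0≢1+n (≡.sym eq))
... | yes _   | no _    | _         = ⊥-elim (ℕ.0≢1+n eq)

remember : ℕ → List ℕ → List ℕ
remember a d with a ∈? d
... | yes _ = d
... | no  _ = d ++ a ∷ []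

∈-remember : ∀ a d → a ∈ remember a d
∈-remember a d with a ∈? d
... | yes a∈d = a∈d
... | no  _   = ∈-++⁺ʳ d (here ≡.refl)

remember-extends : ∀ a d → ∃ λ e → remember a d ≡ d ++ e
remember-extends a d with a ∈? d
... | yes _ = [] , ≡.sym (List.++-identityʳ d)
... | no  _ = a ∷ [] , ≡.refl

index-remember : ∀ a d → index a (remember a d) ≡ index a d
index-remember a d with a ∈? d
... | yes _  = ≡.refl
... | no a∉d = begin
  index a (d ++ a ∷ [])            ≡⟨ index-++-∉ d a∉d ⟩
  length d Nat.+ index a (a ∷ [])  ≡⟨ ≡.cong (length d Nat.+_) (index-here a []) ⟩
  length d Nat.+ 0                 ≡⟨ ℕ.+-identityʳ _ ⟩
  length d                         ≡⟨ index-∉ d a∉d ⟨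
  index a d                        ∎
  where open ≡.≡-Reasoning

length-remember : ∀ a d → length (remember a d) ≡ next (index a d) (length d)
length-remember a d with a ∈? d
... | yes a∈d = ≡.sym (next-≢ (ℕ.<⇒≢ (index-<-∈ a∈d)))
... | no  a∉d = begin
  length (d ++ a ∷ [])         ≡⟨ List.length-++ d ⟩
  length d Nat.+ 1             ≡⟨ ℕ.+-comm (length d) 1 ⟩
  suc (length d)               ≡⟨ next-≡ (length d) ⟨
  next (length d) (length d)   ≡⟨ ≡.cong (λ i → next i (length d)) (index-∉ d a∉d) ⟨
  next (index a d) (length d)  ∎
  where open ≡.≡-Reasoning

-- d lists the labels met so far in order of first occurrence; each label is replaced by its
-- position in d.
labelFrom : ∀ {k} → List ℕ → Vec ℕ k → Vec ℕ k
labelFrom d []      = []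
labelFrom d (a ∷ u) = index a d ∷ labelFrom (remember a d) u

seenAfter : ∀ {k} → List ℕ → Vec ℕ k → List ℕ
seenAfter d []      = d
seenAfter d (a ∷ u) = seenAfter (remember a d) u

seenAfter-extends : ∀ {k} d (u : Vec ℕ k) → ∃ λ e → seenAfter d u ≡ d ++ e
seenAfter-extends d []      = [] , ≡.sym (List.++-identityʳ d)
seenAfter-extends d (a ∷ u) with remember-extends a d | seenAfter-extends (remember a d) u
... | e , r≡ | e′ , s≡ = e ++ e′ , ≡.trans s≡ (≡.trans (≡.cong (_++ e′) r≡) (List.++-assoc d e e′))

∈-seenAfter : ∀ {k} d (u : Vec ℕ k) x → lookup u x ∈ seenAfter d u
∈-seenAfter d (a ∷ u) fzero with seenAfter-extends (remember a d) u
... | e , s≡ = ≡.subst (a ∈_) (≡.sym s≡) (∈-++⁺ˡ (∈-remember a d))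
∈-seenAfter d (a ∷ u) (fsuc x) = ∈-seenAfter (remember a d) u x

lookup-labelFrom : ∀ {k} d (u : Vec ℕ k) x → lookup (labelFrom d u) x ≡ index (lookup u x) (seenAfter d u)
lookup-labelFrom d (a ∷ u) fzero with seenAfter-extends (remember a d) u
... | e , s≡ = begin
  index a d                             ≡⟨ index-remember a d ⟨
  index a (remember a d)                ≡⟨ index-++-∈ (remember a d) (∈-remember a d) ⟨
  index a (remember a d ++ e)           ≡⟨ ≡.cong (index a) s≡ ⟨
  index a (seenAfter (remember a d) u)  ∎
  where open ≡.≡-Reasoning
lookup-labelFrom d (a ∷ u) (fsuc x) = lookup-labelFrom (remember a d) u x

labelFrom-IsRGS : ∀ {k} d (u : Vec ℕ k) → IsRGS (length d) (labelFrom d u)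
labelFrom-IsRGS d []      = _
labelFrom-IsRGS d (a ∷ u) =
  s≤s (index-≤ a d) ,
  ≡.subst (λ m → IsRGS m (labelFrom (remember a d) u)) (length-remember a d) (labelFrom-IsRGS (remember a d) u)

canonical : ∀ {k} → Vec ℕ k → Vec ℕ k
canonical = labelFrom []

canonical-IsRGS : ∀ {k} (u : Vec ℕ k) → IsRGS 0 (canonical u)
canonical-IsRGS = labelFrom-IsRGS []

⊑-canonical : ∀ {k} (u : Vec ℕ k) → u ⊑ canonical u
⊑-canonical u x y ux≡uy rewrite lookup-labelFrom [] u x | lookup-labelFrom [] u y | ux≡uy = ≡.refl

canonical-⊑ : ∀ {k} (u : Vec ℕ k) → canonical u ⊑ u
canonical-⊑ u x y eq rewrite lookup-labelFrom [] u x | lookup-labelFrom [] u y =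
  index-injective (∈-seenAfter [] u x) eq

≤ᵖ-canonical : ∀ {k} (ρ u : Vec ℕ k) → (ρ ≤ᵖ canonical u) ≡ (ρ ≤ᵖ u)
≤ᵖ-canonical ρ u = T-⇔⇒≡
  (λ t → ⊑⇒≤ᵖ ρ u (⊑-trans {π = ρ} {canonical u} {u} (≤ᵖ⇒⊑ ρ (canonical u) t) (canonical-⊑ u)))
  (λ t → ⊑⇒≤ᵖ ρ (canonical u) (⊑-trans {π = ρ} {u} {canonical u} (≤ᵖ⇒⊑ ρ u t) (⊑-canonical u)))

Repeats : ∀ {n} → Vec ℕ n → Fin n → Set
Repeats π j = ∃ λ x → toℕ x < toℕ j × lookup π x ≡ lookup π j

repeats? : ∀ {n} (π : Vec ℕ n) j → Dec (Repeats π j)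
repeats? π j = Fin.any? (λ x → (toℕ x ℕ.<? toℕ j) ×-dec (lookup π x ℕ.≟ lookup π j))

firsts : ∀ {n} → Vec ℕ n → Subset n
firsts π = tabulate (λ j → does (¬? (repeats? π j)))

blocks : ∀ {n} → Vec ℕ n → ℕ
blocks π = ∣ firsts π ∣

∈-firsts⁺ : ∀ {n} (π : Vec ℕ n) {j} → ¬ Repeats π j → j Subset.∈ firsts π
∈-firsts⁺ π {j} ¬r =
  Vec.lookup⇒[]= j _ (≡.trans (Vec.lookup∘tabulate _ j) (dec-true (¬? (repeats? π j)) ¬r))

∈-firsts⁻ : ∀ {n} (π : Vec ℕ n) {j} → j Subset.∈ firsts π → ¬ Repeats π j
∈-firsts⁻ π {j} j∈ r with ≡.trans (≡.sym (Vec.[]=⇒lookup j∈))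
  (≡.trans (Vec.lookup∘tabulate _ j) (dec-false (¬? (repeats? π j)) (λ ¬r → ¬r r)))
... | ()

⊑⇒firsts-⊆ : ∀ {n} {π σ : Vec ℕ n} → π ⊑ σ → firsts σ ⊆ firsts π
⊑⇒firsts-⊆ {π = π} {σ} π⊑σ j∈ = ∈-firsts⁺ π λ (x , x<j , πx≡πj) → ∈-firsts⁻ σ j∈ (x , x<j , π⊑σ _ _ πx≡πj)

-- Strong induction on the later position y: y is a σ-repeat, hence a π-repeat of some x′ < y,
-- and comparing x with x′ reduces the claim to a smaller position.
private
  repeats-⊆⇒⊒-below : ∀ {n} {π σ : Vec ℕ n} → π ⊑ σ → (∀ j → Repeats σ j → Repeats π j) →
    ∀ b y → toℕ y < b → ∀ x → toℕ x < toℕ y → lookup σ x ≡ lookup σ y → lookup π x ≡ lookup π y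
  repeats-⊆⇒⊒-below {π = π} {σ} π⊑σ rep (suc b) y y<b x x<y σx≡σy with rep y (x , x<y , σx≡σy)
  ... | x′ , x′<y , πx′≡πy with ℕ.<-cmp (toℕ x) (toℕ x′)
  ...   | tri≈ _ x≡x′ _ = ≡.trans (≡.cong (lookup π) (Fin.toℕ-injective x≡x′)) πx′≡πy
  ...   | tri< x<x′ _ _ = ≡.trans (below x′ (ℕ.<-≤-trans x′<y (ℕ.≤-pred y<b)) x x<x′
                                     (≡.trans σx≡σy (≡.sym (π⊑σ x′ y πx′≡πy)))) πx′≡πy
    where below = repeats-⊆⇒⊒-below {π = π} {σ} π⊑σ rep b
  ...   | tri> _ _ x′<x = ≡.trans (≡.sym (below x (ℕ.<-≤-trans x<y (ℕ.≤-pred y<b)) x′ x′<x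
                                     (≡.trans (π⊑σ x′ y πx′≡πy) (≡.sym σx≡σy)))) πx′≡πy
    where below = repeats-⊆⇒⊒-below {π = π} {σ} π⊑σ rep b

repeats-⊆⇒⊒ : ∀ {n} {π σ : Vec ℕ n} → π ⊑ σ → (∀ j → Repeats σ j → Repeats π j) → σ ⊑ π
repeats-⊆⇒⊒ {n} {π} {σ} π⊑σ rep x y σx≡σy with ℕ.<-cmp (toℕ x) (toℕ y)
... | tri≈ _ x≡y _ = ≡.cong (lookup π) (Fin.toℕ-injective x≡y)
... | tri< x<y _ _ = repeats-⊆⇒⊒-below {π = π} {σ} π⊑σ rep n y (Fin.toℕ<n y) x x<y σx≡σy
... | tri> _ _ y<x = ≡.sym (repeats-⊆⇒⊒-below {π = π} {σ} π⊑σ rep n x (Fin.toℕ<n x) y y<x (≡.sym σx≡σy))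

blocks-mono : ∀ {n} (π σ : Vec ℕ n) → π ⊑ σ → blocks σ ≤ blocks π
blocks-mono π σ π⊑σ = Subset.p⊆q⇒∣p∣≤∣q∣ (⊑⇒firsts-⊆ {π = π} {σ} π⊑σ)

blocks-strict : ∀ {n} (π σ : Vec ℕ n) → IsRGS 0 π → IsRGS 0 σ → π ⊑ σ → π ≢ σ → blocks σ < blocks π
blocks-strict π σ rπ rσ π⊑σ π≢σ
  with Fin.any? (λ j → repeats? σ j ×-dec ¬? (repeats? π j))
... | yes (j , rσj , ¬rπj) =
  Subset.p⊂q⇒∣p∣<∣q∣ (⊑⇒firsts-⊆ {π = π} {σ} π⊑σ , j , ∈-firsts⁺ π ¬rπj , λ j∈ → ∈-firsts⁻ σ j∈ rσj)
... | no ∄ = ⊥-elim (π≢σ (RGS-⊑-antisym rπ rσ π⊑σ (repeats-⊆⇒⊒ {π = π} {σ} π⊑σ λ j r →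
                decidable-stable (repeats? π j) (λ ¬r → ∄ (j , r , ¬r)))))

singleBlock : ∀ {k} → Vec ℕ (suc k) → Bool
singleBlock {k} (r ∷ y) = eqVec y (replicate k r)

singleBlock⇒ : ∀ {k} {ρ : Vec ℕ (suc k)} → T (singleBlock ρ) → ∀ x → lookup ρ x ≡ lookup ρ fzero
singleBlock⇒ {ρ = r ∷ y} t fzero    = ≡.refl
singleBlock⇒ {k} {r ∷ y} t (fsuc x) =
  ≡.trans (≡.cong (λ v → lookup v x) (eqVec⇒≡ {u = y} {replicate k r} t)) (Vec.lookup-replicate x r)

singleBlock⇐ : ∀ {k} {ρ : Vec ℕ (suc k)} → (∀ x → lookup ρ x ≡ lookup ρ fzero) → T (singleBlock ρ)
singleBlock⇐ {ρ = r ∷ y} h = ≡⇒eqVec {u = y} (constant⇒replicate (h ∘ fsuc))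
  where
  constant⇒replicate : ∀ {k} {y : Vec ℕ k} → (∀ x → lookup y x ≡ r) → y ≡ replicate k r
  constant⇒replicate {y = []}    _ = ≡.refl
  constant⇒replicate {y = a ∷ y} h = ≡.cong₂ _∷_ (h fzero) (constant⇒replicate (h ∘ fsuc))

singleBlock-≤ᵖ : ∀ {k} {ρ : Vec ℕ (suc k)} → T (singleBlock ρ) → ∀ i → (ρ ≤ᵖ i) ≡ singleBlock i
singleBlock-≤ᵖ {ρ = ρ} t i = T-⇔⇒≡
  (λ ρ≤i → singleBlock⇐ {ρ = i} (λ x → ≤ᵖ⇒⊑ ρ i ρ≤i x fzero (singleBlock⇒ {ρ = ρ} t x)))
  (λ s → ⊑⇒≤ᵖ ρ i (λ x y _ → ≡.trans (singleBlock⇒ {ρ = i} s x) (≡.sym (singleBlock⇒ {ρ = i} s y))))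

vectors : List ℕ → (k : ℕ) → List (Vec ℕ k)
vectors L zero    = [] ∷ []
vectors L (suc k) = concatMap (λ l → map (l ∷_) (vectors L k)) L

∈-vectors⇒∈ : ∀ {L k} {v : Vec ℕ k} → v ∈ vectors L k → ∀ x → lookup v x ∈ L
∈-vectors⇒∈ {L} {suc k} v∈ x with find (∈-concatMap⁻ _ {xs = L} v∈)
... | l , l∈ , v∈′ with ∈-map⁻ (l ∷_) v∈′ | x
...   | _ , _  , ≡.refl | fzero  = l∈
...   | _ , y∈ , ≡.refl | fsuc x = ∈-vectors⇒∈ y∈ x

module VectorSums {c ℓ} (R : Semiring c ℓ) where
  open Semiring R
  open ListSum R
  open import Relation.Binary.Reasoning.Setoid setoid

  ∑-∷-eqVec : ∀ {k l} {ls : List ℕ} → Unique ls → l ∈ ls → (ys : ℕ → List (Vec ℕ k))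
              (g : Vec ℕ (suc k) → Carrier) (x : Vec ℕ k) →
              ∑ (concatMap (λ l′ → map (l′ ∷_) (ys l′)) ls) (λ y → g y when eqVec y (l ∷ x))
                ≈ ∑ (ys l) (λ y → g (l ∷ y) when eqVec y x)
  ∑-∷-eqVec {l = l} {ls} uniq l∈ls ys g x = begin
    ∑ (concatMap (λ l′ → map (l′ ∷_) (ys l′)) ls) (λ y → g y when eqVec y (l ∷ x))
      ≈⟨ ∑-concatMap _ ls _ ⟩
    ∑ ls (λ l′ → ∑ (map (l′ ∷_) (ys l′)) (λ y → g y when eqVec y (l ∷ x)))
      ≈⟨ ∑-cong ls (λ l′ → ∑-map (l′ ∷_) (ys l′) _) ⟩
    ∑ ls (λ l′ → ∑ (ys l′) (λ y → g (l′ ∷ y) when ((l′ ≡ᵇ l) ∧ eqVec y x)))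
      ≈⟨ ∑-cong ls (λ l′ → trans (∑-cong (ys l′) (λ y → reflexive (when-∧ _ (l′ ≡ᵇ l) _)))
                                  (∑-when (l′ ≡ᵇ l) (ys l′) _)) ⟩
    ∑ ls (λ l′ → ∑ (ys l′) (λ y → g (l′ ∷ y) when eqVec y x) when (l′ ≡ᵇ l))
      ≈⟨ ∑-when-≡ᵇ uniq l∈ls (λ l′ → ∑ (ys l′) (λ y → g (l′ ∷ y) when eqVec y x)) ⟩
    ∑ (ys l) (λ y → g (l ∷ y) when eqVec y x) ∎

  ∑-rgsFrom-eqVec : ∀ {k m} {x : Vec ℕ k} → IsRGS m x → (g : Vec ℕ k → Carrier) →
                    ∑ (rgsFrom k m) (λ y → g y when eqVec y x) ≈ g x
  ∑-rgsFrom-eqVec {x = []}    _         g = +-identityʳ (g [])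
  ∑-rgsFrom-eqVec {suc k} {m} {l ∷ x} (l≤m , r) g =
    trans (∑-∷-eqVec (upTo⁺ _) (∈-upTo⁺ l≤m) (λ l′ → rgsFrom k (next l′ m)) g x)
          (∑-rgsFrom-eqVec r (g ∘ (l ∷_)))

  ∑-Π-singleBlock : ∀ m (g : Vec ℕ (suc m) → Carrier) →
                    ∑ (Π (suc m)) (λ ρ → g ρ when singleBlock ρ) ≈ g (top (suc m))
  ∑-Π-singleBlock m g =
    trans (∑-cong-∈ (Π (suc m)) λ ρ∈ →
             reflexive (≡.cong (g _ when_) (singleBlock≡eqVec-top (∈-rgsFrom⇒IsRGS ρ∈))))
          (∑-rgsFrom-eqVec {m = 0} (s≤s z≤n , replicate-0-IsRGS m) g)
    where
    singleBlock≡eqVec-top : ∀ {ρ : Vec ℕ (suc m)} → IsRGS 0 ρ → singleBlock ρ ≡ eqVec ρ (top (suc m))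
    singleBlock≡eqVec-top {_ ∷ _} (s≤s z≤n , _) = ≡.refl
    replicate-0-IsRGS : ∀ k → IsRGS 1 (replicate k 0)
    replicate-0-IsRGS zero    = _
    replicate-0-IsRGS (suc k) = s≤s z≤n , replicate-0-IsRGS k

  ∑-vectors-∷ : ∀ L k (F : Vec ℕ (suc k) → Carrier) →
                ∑ (vectors L (suc k)) F ≈ ∑ L (λ l → ∑ (vectors L k) (λ y → F (l ∷ y)))
  ∑-vectors-∷ L k F = trans (∑-concatMap _ L F) (∑-cong L (λ l → ∑-map (l ∷_) (vectors L k) F))

  ∑-vectors-replicate : ∀ {L l} → Unique L → l ∈ L → ∀ k (g : Vec ℕ k → Carrier) →
                        ∑ (vectors L k) (λ y → g y when eqVec y (replicate k l)) ≈ g (replicate k l)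
  ∑-vectors-replicate         _    _   zero    g = +-identityʳ (g [])
  ∑-vectors-replicate {L} {l} uniq l∈L (suc k) g =
    trans (∑-∷-eqVec uniq l∈L (λ _ → vectors L k) g (replicate k l))
          (∑-vectors-replicate uniq l∈L k (g ∘ (l ∷_)))

-- The Möbius function of Πₙ

halfOpen : ∀ {n} → Vec ℕ n → Vec ℕ n → Vec ℕ n → Bool
halfOpen π σ ρ = (π ≤ᵖ ρ) ∧ (ρ <ᵖ σ)

halfOpen⇒ : ∀ {n} (π σ ρ : Vec ℕ n) → T (halfOpen π σ ρ) → π ⊑ ρ × ρ ⊑ σ × ρ ≢ σ
halfOpen⇒ π σ ρ t with Equivalence.to (T-∧ {π ≤ᵖ ρ}) t
... | π≤ρ , ρ<σ with Equivalence.to (T-∧ {ρ ≤ᵖ σ}) ρ<σ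
...   | ρ≤σ , ρ≢σ = ≤ᵖ⇒⊑ π ρ π≤ρ , ≤ᵖ⇒⊑ ρ σ ρ≤σ , λ ρ≡σ → T-not-¬ ρ≢σ (≡⇒eqVec ρ≡σ)
  where
  T-not-¬ : ∀ {p} → T (not p) → ¬ T p
  T-not-¬ {true} ()

halfOpen-blocks : ∀ {n} (π σ ρ : Vec ℕ n) → IsRGS 0 ρ → IsRGS 0 σ → T (halfOpen π σ ρ) →
                  blocks π ∸ blocks ρ < blocks π ∸ blocks σ
halfOpen-blocks π σ ρ rρ rσ t with halfOpen⇒ π σ ρ t
... | π⊑ρ , ρ⊑σ , ρ≢σ = ℕ.∸-monoʳ-< (blocks-strict ρ σ rρ rσ ρ⊑σ ρ≢σ) (blocks-mono π ρ π⊑ρ)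

module Möbius {c ℓ} (K : Field c ℓ) (n : ℕ) where
  open Field K
  open ListSum semiring
  open VectorSums semiring
  open import Relation.Binary.Reasoning.Setoid setoid

  μ′ : ℕ → Vec ℕ n → Vec ℕ n → Carrier
  μ′ fuel = möbiusF K fuel n

  -- Along π ≤ ρ < σ the number of blocks drops strictly, so the recursion of möbiusF never needs
  -- more than blocks π ∸ blocks σ units of fuel.
  μ-fuel : ∀ fuel {π σ} → IsRGS 0 π → IsRGS 0 σ → blocks π ∸ blocks σ < fuel →
           μ′ fuel π σ ≈ μ′ (suc fuel) π σ
  μ-fuel (suc fuel) {π} {σ} rπ rσ bound = unfolded
    where
    unfolded : (if eqVec π σ then 1# else if π ≤ᵖ σ
                 then - ∑ (filter (λ ρ → T? (halfOpen π σ ρ)) (Π n)) (μ′ fuel π) else 0#)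
             ≈ (if eqVec π σ then 1# else if π ≤ᵖ σ
                 then - ∑ (filter (λ ρ → T? (halfOpen π σ ρ)) (Π n)) (μ′ (suc fuel) π) else 0#)
    unfolded with eqVec π σ | π ≤ᵖ σ
    ... | true  | _     = refl
    ... | false | false = refl
    ... | false | true  = -‿cong (∑-cong-∈ _ λ {ρ} ρ∈ →
      let ρ∈Π , t = ∈-filter⁻ (λ ρ → T? (halfOpen π σ ρ)) ρ∈
          rρ = ∈-rgsFrom⇒IsRGS ρ∈Π
      in μ-fuel fuel rπ rρ (ℕ.<-≤-trans (halfOpen-blocks π σ ρ rρ rσ t) (ℕ.≤-pred bound)))

  private
    when-∧-split : ∀ p q r x → x when (p ∧ q) ≈ x when (p ∧ (q ∧ not r)) + x when (p ∧ q) when r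
    when-∧-split true  true  true  x = sym (+-identityˡ x)
    when-∧-split true  true  false x = sym (+-identityʳ x)
    when-∧-split true  false true  x = sym (+-identityˡ 0#)
    when-∧-split true  false false x = sym (+-identityˡ 0#)
    when-∧-split false q     true  x = sym (+-identityˡ 0#)
    when-∧-split false q     false x = sym (+-identityˡ 0#)

    halfOpenSum : Vec ℕ n → Vec ℕ n → Carrier
    halfOpenSum π τ = ∑ (Π n) (λ ρ → μ K n π ρ when halfOpen π τ ρ)

    halfOpenSum-≡ : ∀ π τ → IsRGS 0 π → π ≡ τ → halfOpenSum π τ ≈ 0#
    halfOpenSum-≡ π _ rπ ≡.refl = ∑-when-none _ (Π n) _ λ {ρ} ρ∈ t →
      let π⊑ρ , ρ⊑π , ρ≢π = halfOpen⇒ π π ρ t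
      in ρ≢π (RGS-⊑-antisym (∈-rgsFrom⇒IsRGS ρ∈) rπ ρ⊑π π⊑ρ)

    halfOpenSum-≰ : ∀ π τ → ¬ T (π ≤ᵖ τ) → halfOpenSum π τ ≈ 0#
    halfOpenSum-≰ π τ π≰τ = ∑-when-none _ (Π n) _ λ {ρ} _ t →
      let π⊑ρ , ρ⊑τ , _ = halfOpen⇒ π τ ρ t
      in π≰τ (⊑⇒≤ᵖ π τ (⊑-trans {π = π} {ρ} {τ} π⊑ρ ρ⊑τ))

    μ-≡ : ∀ π τ → T (eqVec π τ) → μ K n π τ ≡ 1#
    μ-≡ π τ π=τ = if-T 1# _ π=τ

    μ-< : ∀ π τ → IsRGS 0 π → IsRGS 0 τ → ¬ T (eqVec π τ) → T (π ≤ᵖ τ) →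
          μ K n π τ ≈ - halfOpenSum π τ
    μ-< π τ rπ rτ π≠τ π≤τ = begin
      μ K n π τ                                                 ≡⟨ ≡.trans (if-¬T 1# _ π≠τ) (if-T _ 0# π≤τ) ⟩
      - ∑ (filter (λ ρ → T? (halfOpen π τ ρ)) (Π n)) (μ′ n π)   ≈⟨ -‿cong (∑-filter (halfOpen π τ) (Π n) (μ′ n π)) ⟩
      - ∑ (Π n) (λ ρ → μ′ n π ρ when halfOpen π τ ρ)
        ≈⟨ -‿cong (∑-cong-∈ (Π n) λ {ρ} ρ∈ → when-cong-T (halfOpen π τ ρ) λ t →
             let rρ = ∈-rgsFrom⇒IsRGS ρ∈ in
             μ-fuel n rπ rρ (ℕ.<-≤-trans (halfOpen-blocks π τ ρ rρ rτ t)
               (ℕ.≤-trans (ℕ.m∸n≤m (blocks π) (blocks τ)) (Subset.∣p∣≤n (firsts π))))) ⟩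
      - halfOpenSum π τ                                         ∎

    halfOpenSum+μ : ∀ {π τ} → IsRGS 0 π → IsRGS 0 τ →
                    halfOpenSum π τ + μ K n π τ when (π ≤ᵖ τ) ≈ 1# when eqVec π τ
    halfOpenSum+μ {π} {τ} rπ rτ with T? (eqVec π τ) | T? (π ≤ᵖ τ)
    ... | yes π=τ | _ = begin
      halfOpenSum π τ + μ K n π τ when (π ≤ᵖ τ)
        ≈⟨ +-cong (halfOpenSum-≡ π τ rπ π≡τ) (reflexive (≡.trans (when-T _ π≤τ) (μ-≡ π τ π=τ))) ⟩
      0# + 1#            ≈⟨ +-identityˡ 1# ⟩
      1#                 ≡⟨ when-T 1# π=τ ⟨
      1# when eqVec π τ  ∎
      where
      π≡τ = eqVec⇒≡ π=τ
      π≤τ = ⊑⇒≤ᵖ π τ (≡.subst (π ⊑_) π≡τ (⊑-refl π))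
    ... | no π≠τ | no π≰τ = begin
      halfOpenSum π τ + μ K n π τ when (π ≤ᵖ τ)
        ≈⟨ +-cong (halfOpenSum-≰ π τ π≰τ) (reflexive (when-¬T _ π≰τ)) ⟩
      0# + 0#            ≈⟨ +-identityˡ 0# ⟩
      0#                 ≡⟨ when-¬T 1# π≠τ ⟨
      1# when eqVec π τ  ∎
    ... | no π≠τ | yes π≤τ = begin
      halfOpenSum π τ + μ K n π τ when (π ≤ᵖ τ)
        ≈⟨ +-congˡ (trans (reflexive (when-T _ π≤τ)) (μ-< π τ rπ rτ π≠τ π≤τ)) ⟩
      halfOpenSum π τ + - halfOpenSum π τ  ≈⟨ -‿inverseʳ _ ⟩
      0#                                   ≡⟨ when-¬T 1# π≠τ ⟨
      1# when eqVec π τ                    ∎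

  ∑-μ-interval : ∀ {π τ} → IsRGS 0 π → IsRGS 0 τ →
                 ∑ (Π n) (λ ρ → μ K n π ρ when ((π ≤ᵖ ρ) ∧ (ρ ≤ᵖ τ))) ≈ 1# when eqVec π τ
  ∑-μ-interval {π} {τ} rπ rτ = begin
    ∑ (Π n) (λ ρ → μ K n π ρ when ((π ≤ᵖ ρ) ∧ (ρ ≤ᵖ τ)))
      ≈⟨ ∑-cong (Π n) (λ ρ → when-∧-split (π ≤ᵖ ρ) (ρ ≤ᵖ τ) (eqVec ρ τ) _) ⟩
    ∑ (Π n) (λ ρ → μ K n π ρ when halfOpen π τ ρ + μ K n π ρ when ((π ≤ᵖ ρ) ∧ (ρ ≤ᵖ τ)) when eqVec ρ τ)
      ≈⟨ ∑-+ (Π n) _ _ ⟩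
    halfOpenSum π τ + ∑ (Π n) (λ ρ → μ K n π ρ when ((π ≤ᵖ ρ) ∧ (ρ ≤ᵖ τ)) when eqVec ρ τ)
      ≈⟨ +-congˡ (∑-rgsFrom-eqVec rτ _) ⟩
    halfOpenSum π τ + μ K n π τ when ((π ≤ᵖ τ) ∧ (τ ≤ᵖ τ))
      ≡⟨ ≡.cong (λ b → halfOpenSum π τ + μ K n π τ when ((π ≤ᵖ τ) ∧ b))
                (Equivalence.to (T-≡ {τ ≤ᵖ τ}) (⊑⇒≤ᵖ τ τ (⊑-refl τ))) ⟩
    halfOpenSum π τ + μ K n π τ when ((π ≤ᵖ τ) ∧ true)
      ≡⟨ ≡.cong (λ b → halfOpenSum π τ + μ K n π τ when b) (∧-identityʳ (π ≤ᵖ τ)) ⟩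
    halfOpenSum π τ + μ K n π τ when (π ≤ᵖ τ)
      ≈⟨ halfOpenSum+μ rπ rτ ⟩
    1# when eqVec π τ ∎

-- Sums of powers of a primitive root of unity

countᵇ-<-¬replicate : ∀ {k a} (y : Vec ℕ k) → ¬ T (eqVec y (replicate k a)) → countᵇ (_≡ᵇ a) y < k
countᵇ-<-¬replicate []      ¬t = ⊥-elim (¬t _)
countᵇ-<-¬replicate {a = a} (r ∷ y) ¬t with r ≡ᵇ a
... | true  = s≤s (countᵇ-<-¬replicate y ¬t)
... | false = s≤s (Vec.count≤n (T? ∘ (_≡ᵇ a)) y)

module Rotation (n : ℕ) where

  rotate : ℕ → ℕ
  rotate k = if k ≡ᵇ n then 1 else suc k

  rotate-n : rotate n ≡ 1
  rotate-n = if-T 1 (suc n) (ℕ.≡⇒≡ᵇ n n ≡.refl)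

  rotate-≢ : ∀ {l} → l ≢ n → rotate l ≡ suc l
  rotate-≢ {l} l≢n = if-¬T 1 (suc l) (l≢n ∘ ℕ.≡ᵇ⇒≡ l n)

  rotateIf : Bool → ℕ → ℕ
  rotateIf b l = if b then rotate l else l

  rotateIf-injective : ∀ b {l l′} → l ≢ 0 → l′ ≢ 0 → rotateIf b l ≡ rotateIf b l′ → l ≡ l′
  rotateIf-injective false _ _ eq = eq
  rotateIf-injective true {l} {l′} l≢0 l′≢0 eq with l ≡ᵇ n in l≡ᵇn | l′ ≡ᵇ n in l′≡ᵇn
  ... | true  | true  = ≡.trans (ℕ.≡ᵇ⇒≡ l n (Equivalence.from T-≡ l≡ᵇn))
                                (≡.sym (ℕ.≡ᵇ⇒≡ l′ n (Equivalence.from T-≡ l′≡ᵇn)))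
  ... | false | false = ℕ.suc-injective eq
  ... | true  | false = ⊥-elim (l′≢0 (ℕ.suc-injective (≡.sym eq)))
  ... | false | true  = ⊥-elim (l≢0 (ℕ.suc-injective eq))

  shiftBlock : ∀ {k} → ℕ → Vec ℕ k → Vec ℕ k → Vec ℕ k
  shiftBlock a = zipWith (λ r → rotateIf (r ≡ᵇ a))

  shiftBlock-≤ᵖ : ∀ {k} a (ρ i : Vec ℕ k) → (∀ x → lookup i x ≢ 0) → (ρ ≤ᵖ shiftBlock a ρ i) ≡ (ρ ≤ᵖ i)
  shiftBlock-≤ᵖ a ρ i nonzero = T-⇔⇒≡
    (λ t → ⊑⇒≤ᵖ ρ i λ x y ρx≡ρy → rotateIf-injective (lookup ρ y ≡ᵇ a) (nonzero x) (nonzero y) (begin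
      rotateIf (lookup ρ y ≡ᵇ a) (lookup i x)  ≡⟨ ≡.cong (λ r → rotateIf (r ≡ᵇ a) (lookup i x)) ρx≡ρy ⟨
      rotateIf (lookup ρ x ≡ᵇ a) (lookup i x)  ≡⟨ lookup-shift x ⟨
      lookup (shiftBlock a ρ i) x              ≡⟨ ≤ᵖ⇒⊑ ρ (shiftBlock a ρ i) t x y ρx≡ρy ⟩
      lookup (shiftBlock a ρ i) y              ≡⟨ lookup-shift y ⟩
      rotateIf (lookup ρ y ≡ᵇ a) (lookup i y)  ∎))
    (λ t → ⊑⇒≤ᵖ ρ (shiftBlock a ρ i) λ x y ρx≡ρy → begin
      lookup (shiftBlock a ρ i) x              ≡⟨ lookup-shift x ⟩
      rotateIf (lookup ρ x ≡ᵇ a) (lookup i x)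
        ≡⟨ ≡.cong₂ (λ r → rotateIf (r ≡ᵇ a)) ρx≡ρy (≤ᵖ⇒⊑ ρ i t x y ρx≡ρy) ⟩
      rotateIf (lookup ρ y ≡ᵇ a) (lookup i y)  ≡⟨ lookup-shift y ⟨
      lookup (shiftBlock a ρ i) y              ∎)
    where
    open ≡.≡-Reasoning
    lookup-shift : ∀ x → lookup (shiftBlock a ρ i) x ≡ rotateIf (lookup ρ x ≡ᵇ a) (lookup i x)
    lookup-shift x = Vec.lookup-zipWith _ x ρ i

module RootOfUnitySum {c ℓ} (K : Field c ℓ) (m : ℕ) (ω : Field.Carrier K)
                      (prim : PrimitiveRoot K (suc m) ω) where
  open Field K
  open ListSum semiring
  open VectorSums semiring
  open FieldProperties K
  open Rotation (suc m)
  open import Algebra.Properties.CommutativeSemigroup *-commutativeSemigroup using (interchange; x∙yz≈y∙xz)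
  open import Relation.Binary.Reasoning.Setoid setoid

  indices : List ℕ
  indices = map suc (upTo (suc m))

  ω^ : ℕ → Carrier
  ω^ = powK K ω

  indices-unique : Unique indices
  indices-unique = Unique-map⁺ ℕ.suc-injective (upTo⁺ (suc m))

  ∈-indices⇒≢0 : ∀ {l} → l ∈ indices → l ≢ 0
  ∈-indices⇒≢0 l∈ with ∈-map⁻ suc l∈
  ... | _ , _ , ≡.refl = λ ()

  ∑-indices-rotate : ∀ H → ∑ indices (H ∘ rotate) ≈ ∑ indices H
  ∑-indices-rotate H = begin
    ∑ indices (H ∘ rotate)                   ≈⟨ ∑-map suc (upTo (suc m)) _ ⟩
    ∑ (upTo (suc m)) (H ∘ rotate ∘ suc)
      ≡⟨ ≡.cong (λ xs → ∑ xs (H ∘ rotate ∘ suc)) (List.applyUpTo-∷ʳ id m) ⟨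
    ∑ (upTo m ∷ʳ m) (H ∘ rotate ∘ suc)       ≈⟨ ∑-++ (upTo m) (m ∷ []) _ ⟩
    ∑ (upTo m) (H ∘ rotate ∘ suc) + (H (rotate (suc m)) + 0#)
      ≈⟨ +-cong (∑-cong-∈ (upTo m) λ k∈ → reflexive (≡.cong H (rotate-≢ (ℕ.<⇒≢ (s≤s (∈-upTo⁻ k∈))))))
                (trans (+-identityʳ _) (reflexive (≡.cong H rotate-n))) ⟩
    ∑ (upTo m) (H ∘ suc ∘ suc) + H 1         ≈⟨ +-comm _ _ ⟩
    H 1 + ∑ (upTo m) (H ∘ suc ∘ suc)         ≈⟨ +-congˡ (∑-map suc (upTo m) (H ∘ suc)) ⟨
    H 1 + ∑ (map suc (upTo m)) (H ∘ suc)
      ≡⟨ ≡.cong (λ xs → H 1 + ∑ xs (H ∘ suc)) (List.map-applyUpTo id suc m) ⟩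
    H 1 + ∑ (applyUpTo suc m) (H ∘ suc)      ≈⟨ +-congˡ (∑-map suc (applyUpTo suc m) H) ⟨
    ∑ indices H                              ∎

  ∑-indices-rotateIf : ∀ b H → ∑ indices (H ∘ rotateIf b) ≈ ∑ indices H
  ∑-indices-rotateIf true  H = ∑-indices-rotate H
  ∑-indices-rotateIf false H = refl

  ∑-vectors-shiftBlock : ∀ a {k} (ρ : Vec ℕ k) (F : Vec ℕ k → Carrier) →
                         ∑ (vectors indices k) (F ∘ shiftBlock a ρ) ≈ ∑ (vectors indices k) F
  ∑-vectors-shiftBlock a []      F = refl
  ∑-vectors-shiftBlock a {suc k} (r ∷ ρ) F = begin
    ∑ (vectors indices (suc k)) (F ∘ shiftBlock a (r ∷ ρ))
      ≈⟨ ∑-vectors-∷ indices k _ ⟩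
    ∑ indices (λ l → ∑ (vectors indices k) (λ y → F (rotateIf (r ≡ᵇ a) l ∷ shiftBlock a ρ y)))
      ≈⟨ ∑-cong indices (λ l → ∑-vectors-shiftBlock a ρ (λ y → F (rotateIf (r ≡ᵇ a) l ∷ y))) ⟩
    ∑ indices (λ l → ∑ (vectors indices k) (λ y → F (rotateIf (r ≡ᵇ a) l ∷ y)))
      ≈⟨ ∑-indices-rotateIf (r ≡ᵇ a) (λ l → ∑ (vectors indices k) (λ y → F (l ∷ y))) ⟩
    ∑ indices (λ l → ∑ (vectors indices k) (λ y → F (l ∷ y)))
      ≈⟨ ∑-vectors-∷ indices k F ⟨
    ∑ (vectors indices (suc k)) F ∎

  powK-rotate : ∀ l → ω^ (rotate l) ≈ ω * ω^ l
  powK-rotate l with l ℕ.≟ suc m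
  ... | yes ≡.refl = trans (reflexive (≡.cong ω^ rotate-n)) (*-congˡ (sym (proj₁ prim)))
  ... | no  l≢n    = reflexive (≡.cong ω^ (rotate-≢ l≢n))

  weight-shiftBlock : ∀ a {k} (ρ i : Vec ℕ k) →
                      weight ω^ (shiftBlock a ρ i) ≈ ω^ (countᵇ (_≡ᵇ a) ρ) * weight ω^ i
  weight-shiftBlock a []      []      = sym (*-identityʳ 1#)
  weight-shiftBlock a (r ∷ ρ) (l ∷ i) with r ≡ᵇ a
  ... | true  = begin
    ω^ (rotate l) * weight ω^ (shiftBlock a ρ i)       ≈⟨ *-cong (powK-rotate l) (weight-shiftBlock a ρ i) ⟩
    (ω * ω^ l) * (ω^ (countᵇ (_≡ᵇ a) ρ) * weight ω^ i) ≈⟨ interchange _ _ _ _ ⟩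
    (ω * ω^ (countᵇ (_≡ᵇ a) ρ)) * (ω^ l * weight ω^ i) ∎
  ... | false = begin
    ω^ l * weight ω^ (shiftBlock a ρ i)               ≈⟨ *-congˡ (weight-shiftBlock a ρ i) ⟩
    ω^ l * (ω^ (countᵇ (_≡ᵇ a) ρ) * weight ω^ i)      ≈⟨ x∙yz≈y∙xz _ _ _ ⟩
    ω^ (countᵇ (_≡ᵇ a) ρ) * (ω^ l * weight ω^ i)      ∎

  ∑-singleBlock : ∑ (vectors indices (suc m)) (λ i → weight ω^ i when singleBlock i) ≈ natK K (suc m)
  ∑-singleBlock = begin
    ∑ (vectors indices (suc m)) (λ i → weight ω^ i when singleBlock i)
      ≈⟨ ∑-vectors-∷ indices m _ ⟩
    ∑ indices (λ l → ∑ (vectors indices m) (λ y → weight ω^ (l ∷ y) when eqVec y (replicate m l)))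
      ≈⟨ ∑-cong-∈ indices (λ l∈ → ∑-vectors-replicate indices-unique l∈ m _) ⟩
    ∑ indices (λ l → weight ω^ (replicate (suc m) l))
      ≈⟨ ∑-cong indices (λ l → trans (weight-replicate (suc m) l) (powK-root ω (suc m) (proj₁ prim) l)) ⟩
    ∑ indices (λ _ → 1#)
      ≈⟨ ∑-1 indices ⟩
    natK K (length indices)
      ≡⟨ ≡.cong (natK K) (≡.trans (List.length-map suc (upTo (suc m))) (List.length-upTo (suc m))) ⟩
    natK K (suc m) ∎
    where
    weight-replicate : ∀ k l → weight ω^ (replicate k l) ≈ powK K (ω^ l) k
    weight-replicate zero    l = refl
    weight-replicate (suc k) l = *-congˡ (weight-replicate k l)

  -- Rotating the indices on the block of the first position multiplies the sum by ω^c,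
  -- c the size of that block; as 0 < c < n, ω^c ≉ 1.
  ∑-weight-≤ᵖ : ∀ ρ → ∑ (vectors indices (suc m)) (λ i → weight ω^ i when (ρ ≤ᵖ i))
                        ≈ natK K (suc m) when singleBlock ρ
  ∑-weight-≤ᵖ ρ with T? (singleBlock ρ)
  ... | yes s = begin
    ∑ (vectors indices (suc m)) (λ i → weight ω^ i when (ρ ≤ᵖ i))
      ≈⟨ ∑-cong (vectors indices (suc m)) (λ i →
           reflexive (≡.cong (weight ω^ i when_) (singleBlock-≤ᵖ {ρ = ρ} s i))) ⟩
    ∑ (vectors indices (suc m)) (λ i → weight ω^ i when singleBlock i)
      ≈⟨ ∑-singleBlock ⟩
    natK K (suc m)                     ≡⟨ when-T _ s ⟨
    natK K (suc m) when singleBlock ρ  ∎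
  ∑-weight-≤ᵖ ρ@(r ∷ y) | no ¬s = begin
    S                                  ≈⟨ fixed-by-≉1⇒≈0 ω^b≉1 S≈ω^bS ⟩
    0#                                 ≡⟨ when-¬T _ ¬s ⟨
    natK K (suc m) when singleBlock ρ  ∎
    where
    V = vectors indices (suc m)
    S = ∑ V (λ i → weight ω^ i when (ρ ≤ᵖ i))
    b = countᵇ (_≡ᵇ r) y
    ω^b≉1 : ¬ ω^ (suc b) ≈ 1#
    ω^b≉1 = proj₂ prim (suc b) (s≤s z≤n) (s≤s (countᵇ-<-¬replicate y ¬s))
    count-ρ : countᵇ (_≡ᵇ r) ρ ≡ suc b
    count-ρ = ≡.cong (λ f → f b) (if-T suc id (ℕ.≡⇒≡ᵇ r r ≡.refl))
    S≈ω^bS : S ≈ ω^ (suc b) * S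
    S≈ω^bS = begin
      S                                                               ≈⟨ ∑-vectors-shiftBlock r ρ _ ⟨
      ∑ V (λ i → weight ω^ (shiftBlock r ρ i) when (ρ ≤ᵖ shiftBlock r ρ i))
        ≈⟨ ∑-cong-∈ V (λ {i} i∈ → trans
             (reflexive (≡.cong (weight ω^ (shiftBlock r ρ i) when_)
                                (shiftBlock-≤ᵖ r ρ i (∈-indices⇒≢0 ∘ ∈-vectors⇒∈ i∈))))
             (when-cong-T (ρ ≤ᵖ i) λ _ → trans (weight-shiftBlock r ρ i)
                                               (reflexive (≡.cong (λ k → ω^ k * weight ω^ i) count-ρ)))) ⟩
      ∑ V (λ i → ω^ (suc b) * weight ω^ i when (ρ ≤ᵖ i))              ≈⟨ ∑-cong V (λ i → *-when _ _ (ρ ≤ᵖ i)) ⟨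
      ∑ V (λ i → ω^ (suc b) * (weight ω^ i when (ρ ≤ᵖ i)))            ≈⟨ *-∑ _ V _ ⟨
      ω^ (suc b) * S                                                  ∎

-- Exchangeability

transpose : ℕ → ℕ → ℕ → ℕ
transpose a b z with z ℕ.≟ a
... | yes _ = b
... | no  _ with z ℕ.≟ b
...   | yes _ = a
...   | no  _ = z

transpose-a : ∀ a b → transpose a b a ≡ b
transpose-a a b with a ℕ.≟ a
... | yes _   = ≡.refl
... | no a≢a  = ⊥-elim (a≢a ≡.refl)

transpose-b : ∀ a b → transpose a b b ≡ a
transpose-b a b with b ℕ.≟ a
... | yes b≡a = b≡a
... | no  _ with b ℕ.≟ b
...   | yes _   = ≡.refl
...   | no b≢b  = ⊥-elim (b≢b ≡.refl)

transpose-fixes : ∀ {a b z} → (z ≡ a → z ≡ b) → (z ≡ b → z ≡ a) → transpose a b z ≡ z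
transpose-fixes {a} {b} {z} z≡a⇒z≡b z≡b⇒z≡a with z ℕ.≟ a
... | yes z≡a = ≡.sym (z≡a⇒z≡b z≡a)
... | no  _ with z ℕ.≟ b
...   | yes z≡b = ≡.sym (z≡b⇒z≡a z≡b)
...   | no  _   = ≡.refl

transpose-involutive : ∀ a b z → transpose a b (transpose a b z) ≡ z
transpose-involutive a b z with z ℕ.≟ a
... | yes z≡a = ≡.trans (transpose-b a b) (≡.sym z≡a)
... | no z≢a with z ℕ.≟ b
...   | yes z≡b = ≡.trans (transpose-a a b) (≡.sym z≡b)
...   | no z≢b  = transpose-fixes (⊥-elim ∘ z≢a) (⊥-elim ∘ z≢b)

transpose↔ : ℕ → ℕ → ℕ ↔ ℕ
transpose↔ a b = mk↔ₛ′ (transpose a b) (transpose a b) (transpose-involutive a b) (transpose-involutive a b)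

module ExchangeabilityProperties {c ℓ a ℓa u ℓu} {K : Field c ℓ} {𝒜 : NCProbSpace K a ℓa}
                                 (ℰ : ExchangeabilitySystem 𝒜 u ℓu) where
  private
    module K = Field K
    module A = UnitalAlgebra (NCProbSpace.alg 𝒜)
    module ℰ = ExchangeabilitySystem ℰ
    𝒰 = NCProbSpace.alg ℰ.𝒰
    module U = UnitalAlgebra 𝒰
    module φ̃ = IsState (NCProbSpace.isState ℰ.𝒰)

  word : ∀ {k} → (Fin k → A.Carrier) → (Fin k → ℕ) → U.Carrier
  word {k} X i = prodA 𝒰 k (λ j → ℰ.ι (i j) (X j))

  word-cong : ∀ {k} (X : Fin k → A.Carrier) {i i′ : Fin k → ℕ} → (∀ j → i j ≡ i′ j) → word X i U.≈ word X i′
  word-cong {zero}  X eq = U.refl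
  word-cong {suc k} X eq = U.*-cong (U.reflexive (≡.cong (λ l → ℰ.ι l (X fzero)) (eq fzero)))
                                    (word-cong (X ∘ fsuc) (eq ∘ fsuc))

  SameKernel : ∀ {k} → (Fin k → ℕ) → (Fin k → ℕ) → Set
  SameKernel i i′ = (∀ x y → i x ≡ i y → i′ x ≡ i′ y) × (∀ x y → i′ x ≡ i′ y → i x ≡ i y)

  -- Each position p of ps is fixed by a transposition, which preserves the kernel and,
  -- by exchangeability, the value of φ̃.
  private
    φ̃-word-kernel-outside : ∀ {k} (X : Fin k → A.Carrier) (ps : List (Fin k)) {i i′} → SameKernel i i′ →
                            (∀ x → x ∉ ps → i x ≡ i′ x) → ℰ.φ̃ (word X i) K.≈ ℰ.φ̃ (word X i′)
    φ̃-word-kernel-outside X []       _       agree = φ̃.cong (word-cong X (λ x → agree x λ ()))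
    φ̃-word-kernel-outside X (p ∷ ps) {i} {i′} (i⇒i′ , i′⇒i) agree =
      K.trans (ℰ.exchangeable _ X i (transpose↔ (i p) (i′ p)))
              (φ̃-word-kernel-outside X ps (τi⇒i′ , i′⇒τi) agree′)
      where
      τ = transpose (i p) (i′ p)
      τi⇒i′ : ∀ x y → τ (i x) ≡ τ (i y) → i′ x ≡ i′ y
      τi⇒i′ x y eq = i⇒i′ x y (≡.trans (≡.sym (transpose-involutive _ _ (i x)))
                                  (≡.trans (≡.cong τ eq) (transpose-involutive _ _ (i y))))
      i′⇒τi : ∀ x y → i′ x ≡ i′ y → τ (i x) ≡ τ (i y)
      i′⇒τi x y eq = ≡.cong τ (i′⇒i x y eq)
      agree′ : ∀ x → x ∉ ps → τ (i x) ≡ i′ x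
      agree′ x x∉ps with x Fin.≟ p
      ... | yes ≡.refl = transpose-a (i x) (i′ x)
      ... | no x≢p = ≡.trans (transpose-fixes (λ ix≡ip → ≡.trans ix≡i′x (i⇒i′ x p ix≡ip))
                                              (λ ix≡i′p → i′⇒i x p (≡.trans (≡.sym ix≡i′x) ix≡i′p)))
                             ix≡i′x
        where
        ix≡i′x = agree x λ { (here x≡p) → x≢p x≡p ; (there x∈ps) → x∉ps x∈ps }

  φ̃-word-kernel : ∀ {k} (X : Fin k → A.Carrier) {i i′} → SameKernel i i′ → ℰ.φ̃ (word X i) K.≈ ℰ.φ̃ (word X i′)
  φ̃-word-kernel {k} X same = φ̃-word-kernel-outside X (allFin k) same (λ x x∉ → ⊥-elim (x∉ (∈-allFin x)))

  open ListSum K.semiring using (∑; weight)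
  open ListSum U.semiring using () renaming (∑ to ∑ᵁ; ∑-cong to ∑ᵁ-cong; ∑-* to ∑ᵁ-*; *-∑ to *-∑ᵁ)
  open VectorSums U.semiring using () renaming (∑-vectors-∷ to ∑ᵁ-vectors-∷)

  ·-*-· : ∀ s t x y → (s U.· x) U.* (t U.· y) U.≈ (s K.* t) U.· (x U.* y)
  ·-*-· s t x y = begin
    (s U.· x) U.* (t U.· y)  ≈⟨ U.·-*ˡ s x (t U.· y) ⟨
    s U.· (x U.* (t U.· y))  ≈⟨ U.·-cong K.refl (U.·-*ʳ t x y) ⟨
    s U.· (t U.· (x U.* y))  ≈⟨ U.·-assoc s t (x U.* y) ⟨
    (s K.* t) U.· (x U.* y)  ∎
    where open import Relation.Binary.Reasoning.Setoid U.setoid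

  word-expansion : ∀ {k} (X : Fin k → A.Carrier) (L : List ℕ) (f : ℕ → K.Carrier) →
                   prodA 𝒰 k (λ j → ∑ᵁ L (λ l → f l U.· ℰ.ι l (X j)))
                     U.≈ ∑ᵁ (vectors L k) (λ i → weight f i U.· word X (lookup i))
  word-expansion {zero}  X L f = U.sym (U.trans (U.+-identityʳ _) (U.·-identity U.1#))
  word-expansion {suc k} X L f = begin
    x₀ U.* prodA 𝒰 k (λ j → ∑ᵁ L (λ l → f l U.· ℰ.ι l (X (fsuc j))))
      ≈⟨ U.*-congˡ (word-expansion (X ∘ fsuc) L f) ⟩
    x₀ U.* ∑ᵁ V (λ i → weight f i U.· word (X ∘ fsuc) (lookup i))
      ≈⟨ ∑ᵁ-* _ L _ ⟩
    ∑ᵁ L (λ l → (f l U.· ℰ.ι l (X fzero)) U.* ∑ᵁ V (λ i → weight f i U.· word (X ∘ fsuc) (lookup i)))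
      ≈⟨ ∑ᵁ-cong L (λ l → U.trans (*-∑ᵁ _ V _) (∑ᵁ-cong V (λ i → ·-*-· _ _ _ _))) ⟩
    ∑ᵁ L (λ l → ∑ᵁ V (λ i → weight f (l ∷ i) U.· word X (lookup (l ∷ i))))
      ≈⟨ ∑ᵁ-vectors-∷ L k _ ⟨
    ∑ᵁ (vectors L (suc k)) (λ i → weight f i U.· word X (lookup i)) ∎
    where
    open import Relation.Binary.Reasoning.Setoid U.setoid
    V = vectors L k
    x₀ = ∑ᵁ L (λ l → f l U.· ℰ.ι l (X fzero))

  φ̃-linear : ∀ {b} {B : Set b} (xs : List B) (f : B → K.Carrier) (P : B → U.Carrier) →
             ℰ.φ̃ (∑ᵁ xs (λ x → f x U.· P x)) K.≈ ∑ xs (λ x → f x K.* ℰ.φ̃ (P x))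
  φ̃-linear []       f P =
    identityˡ-unique _ _ (K.trans (K.sym (φ̃.additive U.0# U.0#)) (φ̃.cong (U.+-identityˡ U.0#)))
    where open import Algebra.Properties.Group K.+-group using (identityˡ-unique)
  φ̃-linear (x ∷ xs) f P = K.trans (φ̃.additive _ _) (K.+-cong (φ̃.homogeneous _ _) (φ̃-linear xs f P))

module CumulantFormula {c ℓ a ℓa u ℓu} (K : Field c ℓ) {𝒜 : NCProbSpace K a ℓa}
                       (ℰ : ExchangeabilitySystem 𝒜 u ℓu) (m : ℕ) (ω : Field.Carrier K)
                       (prim : PrimitiveRoot K (suc m) ω)
                       (X : Fin (suc m) → UnitalAlgebra.Carrier (NCProbSpace.alg 𝒜)) where
  open Field K
  open ListSum semiring
  open VectorSums semiring
  open Möbius K (suc m)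
  open RootOfUnitySum K m ω prim
  open ExchangeabilityProperties ℰ
  open import Relation.Binary.Reasoning.Setoid setoid

  private
    n = suc m
    φ̃ = ExchangeabilitySystem.φ̃ ℰ
    module U = UnitalAlgebra (NCProbSpace.alg (ExchangeabilitySystem.𝒰 ℰ))
    module φ̃ = IsState (NCProbSpace.isState (ExchangeabilitySystem.𝒰 ℰ))
    open ListSum U.semiring using () renaming (∑ to ∑ᵁ)

  intervalμ : Vec ℕ n → Vec ℕ n → Carrier
  intervalμ π i = ∑ (Π n) (λ ρ → μ K n π ρ when ((π ≤ᵖ ρ) ∧ (ρ ≤ᵖ i)))

  φ̃-word-inversion : ∀ i → φ̃ (word X (lookup i)) ≈ ∑ (Π n) (λ π → φ_ ℰ π X * intervalμ π i)
  φ̃-word-inversion i = begin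
    φ̃ (word X (lookup i))                               ≈⟨ φ̃-word-kernel X (⊑-canonical i , canonical-⊑ i) ⟩
    φ_ ℰ τ X                                            ≈⟨ ∑-rgsFrom-eqVec rτ (λ π → φ_ ℰ π X) ⟨
    ∑ (Π n) (λ π → φ_ ℰ π X when eqVec π τ)             ≈⟨ ∑-cong (Π n) (λ π → when≈*-1-when _ (eqVec π τ)) ⟩
    ∑ (Π n) (λ π → φ_ ℰ π X * (1# when eqVec π τ))
      ≈⟨ ∑-cong-∈ (Π n) (λ π∈ → *-congˡ (∑-μ-interval (∈-rgsFrom⇒IsRGS π∈) rτ)) ⟨
    ∑ (Π n) (λ π → φ_ ℰ π X * intervalμ π τ)
      ≈⟨ ∑-cong (Π n) (λ π → *-congˡ (∑-cong (Π n) (λ ρ →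
           reflexive (≡.cong (λ b → μ K n π ρ when ((π ≤ᵖ ρ) ∧ b)) (≤ᵖ-canonical ρ i))))) ⟩
    ∑ (Π n) (λ π → φ_ ℰ π X * intervalμ π i)            ∎
    where
    τ  = canonical i
    rτ = canonical-IsRGS i

  ∑-weight-intervalμ : ∀ π → ∑ (vectors indices n) (λ i → weight ω^ i * intervalμ π i)
                               ≈ natK K n * μ K n π (top n)
  ∑-weight-intervalμ π = begin
    ∑ V (λ i → weight ω^ i * intervalμ π i)
      ≈⟨ ∑-*-∑-comm V (Π n) (weight ω^) _ ⟩
    ∑ (Π n) (λ ρ → ∑ V (λ i → weight ω^ i * (μ K n π ρ when ((π ≤ᵖ ρ) ∧ (ρ ≤ᵖ i)))))
      ≈⟨ ∑-cong (Π n) (λ ρ → trans (∑-cong V (λ i → *-when-∧ (π ≤ᵖ ρ) (ρ ≤ᵖ i) _ _)) (sym (*-∑ _ V _))) ⟩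
    ∑ (Π n) (λ ρ → μ K n π ρ when (π ≤ᵖ ρ) * ∑ V (λ i → weight ω^ i when (ρ ≤ᵖ i)))
      ≈⟨ ∑-cong (Π n) (λ ρ → *-congˡ (∑-weight-≤ᵖ ρ)) ⟩
    ∑ (Π n) (λ ρ → μ K n π ρ when (π ≤ᵖ ρ) * (natK K n when singleBlock ρ))
      ≈⟨ ∑-cong (Π n) (λ ρ → trans (*-when _ _ (singleBlock ρ))
                                   (when-cong-T (singleBlock ρ) λ _ → *-comm _ _)) ⟩
    ∑ (Π n) (λ ρ → natK K n * (μ K n π ρ when (π ≤ᵖ ρ)) when singleBlock ρ)
      ≈⟨ ∑-Π-singleBlock m (λ ρ → natK K n * (μ K n π ρ when (π ≤ᵖ ρ))) ⟩
    natK K n * (μ K n π (top n) when (π ≤ᵖ top n))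
      ≡⟨ ≡.cong (natK K n *_) (when-T _ (⊑⇒≤ᵖ π (top n) (⊑-top π))) ⟩
    natK K n * μ K n π (top n) ∎
    where
    V = vectors indices n
    *-when-∧ : ∀ p q x y → y * (x when (p ∧ q)) ≈ x when p * (y when q)
    *-when-∧ true  true  x y = *-comm y x
    *-when-∧ true  false x y = trans (zeroʳ y) (sym (zeroʳ x))
    *-when-∧ false q     x y = trans (zeroʳ y) (sym (zeroˡ _))

  φ̃-∏Xω : φ̃ (prodA (NCProbSpace.alg (ExchangeabilitySystem.𝒰 ℰ)) n (λ j → Xω ℰ n ω (X j)))
          ≈ natK K n * ∑ (Π n) (λ π → φ_ ℰ π X * μ K n π (top n))
  φ̃-∏Xω = begin
    φ̃ (prodA (NCProbSpace.alg (ExchangeabilitySystem.𝒰 ℰ)) n (λ j → Xω ℰ n ω (X j)))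
      ≈⟨ φ̃.cong (word-expansion X indices ω^) ⟩
    φ̃ (∑ᵁ V (λ i → weight ω^ i U.· word X (lookup i)))
      ≈⟨ φ̃-linear V (weight ω^) (λ i → word X (lookup i)) ⟩
    ∑ V (λ i → weight ω^ i * φ̃ (word X (lookup i)))
      ≈⟨ ∑-cong V (λ i → *-congˡ (φ̃-word-inversion i)) ⟩
    ∑ V (λ i → weight ω^ i * ∑ (Π n) (λ π → φ_ ℰ π X * intervalμ π i))
      ≈⟨ ∑-*-∑-comm V (Π n) (weight ω^) _ ⟩
    ∑ (Π n) (λ π → ∑ V (λ i → weight ω^ i * (φ_ ℰ π X * intervalμ π i)))
      ≈⟨ ∑-cong (Π n) (λ π → trans (∑-cong V (λ i → x∙yz≈y∙xz _ _ _)) (sym (*-∑ _ V _))) ⟩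
    ∑ (Π n) (λ π → φ_ ℰ π X * ∑ V (λ i → weight ω^ i * intervalμ π i))
      ≈⟨ ∑-cong (Π n) (λ π → *-congˡ (∑-weight-intervalμ π)) ⟩
    ∑ (Π n) (λ π → φ_ ℰ π X * (natK K n * μ K n π (top n)))
      ≈⟨ ∑-cong (Π n) (λ π → x∙yz≈y∙xz _ _ _) ⟩
    ∑ (Π n) (λ π → natK K n * (φ_ ℰ π X * μ K n π (top n)))
      ≈⟨ *-∑ _ (Π n) _ ⟨
    natK K n * ∑ (Π n) (λ π → φ_ ℰ π X * μ K n π (top n)) ∎
    where
    V = vectors indices n
    open import Algebra.Properties.CommutativeSemigroup *-commutativeSemigroup using (x∙yz≈y∙xz)

theorem2p5 : ∀ {c ℓ a ℓa u ℓu} (K : Field c ℓ) (cz : CharZero K)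
               {𝒜 : NCProbSpace K a ℓa} (ℰ : ExchangeabilitySystem 𝒜 u ℓu)
               (m : ℕ) (ω : Field.Carrier K) → PrimitiveRoot K (suc m) ω →
               (X : Fin (suc m) → UnitalAlgebra.Carrier (NCProbSpace.alg 𝒜)) →
               Field._≈_ K (cumulant ℰ (suc m) ω (cz m) X)
                 (sumK K (map (λ π → Field._*_ K (φ_ ℰ π X) (μ K (suc m) π (top (suc m)))) (Π (suc m))))
theorem2p5 K cz ℰ m ω prim X =
  trans (*-congˡ (CumulantFormula.φ̃-∏Xω K ℰ m ω prim X)) (inv-cancelˡ (natK K (suc m)) (cz m) _)
  where
  open Field K
  open FieldProperties K
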